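{- Let $q$ be a prime power with $q\equiv1\pmod4$ such that $2$ is a square in $\mathbb F_q$, fix a square root $\sqrt{ -2}\in\mathbb F_q$ of $-2$, and let $b\in\mathbb F_{q^2}$ with $b\ne0$, $b^q+b=0$. Let $O=(1,0,0,0)$, $P^+=(1,\sqrt{ -2}\,b,b,0)$, $P^-=(1,-\sqrt{ -2}\,b,b,0)$, and let $\ell^+$ (resp. $\ell^-$) be the line joining $O$ and $P^+$ (resp. $P^-$). Then $\ell^+$ and $\ell^-$ are generators of $\mathcal U_3$ lying in different orbits of the group $\mathfrak H$.
   Context: In $\mathrm{PG}(3,q^2)$ with coordinates $(X_0,X_1,X_2,X_3)$ (points as column vectors, matrices acting by $x\mapsto Ax$), $\mathcal U_3$ is the Hermitian surface $X_1^{q+1}+2X_2^{q+1}=X_3^qX_0+X_3X_0^q$; a generator is a line contained in $\mathcal U_3$. $\mathfrak G\le\mathrm{PGU}(4,q)$ is generated by the collineations with matrices $\mathbf T_\alpha=\begin{pmatrix}1&0&0&0\\0&1&0&0\\ \alpha&0&1&0\\ \alpha^2&0&2\alpha&1\end{pmatrix}$ ($\alpha\in\mathbb F_q$), $\mathbf M_\rho=\mathrm{diag}(\rho^{ -1},1,1,\rho)$ ($\rho$ non-zero square in $\mathbb F_q$), $\mathbf L_\lambda=\mathrm{diag}(1,\lambda,1,1)$ ($\lambda\in\mathbb F_{q^2}$, $\lambda^{(q+1)/2}=1$), $\mathbf N_\sigma=\begin{pmatrix}0&0&0&1\\0&\sigma&0&0\\0&0&1&0\\1&0&0&0\end{pmatrix}$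 ($\sigma\in\mathbb F_{q^2}$, $\sigma^{(q+1)/2}=-1$), $\mathbf R_\mu=\begin{pmatrix}0&0&0&\mu^{ -1}\\0&1&0&0\\0&0&1&0\\ \mu&0&0&0\end{pmatrix}$ ($\mu$ non-square in $\mathbb F_q$). $\mathfrak H$ is the subgroup of $\mathfrak G$ generated by all elements of $\mathfrak G$ whose order is a power of the characteristic $p$ of $\mathbb F_q$, together with the collineations $\mathbf L_\lambda$. -}

module Defs where

open import Level using (0ℓ)
open import Data.Nat as ℕ using (ℕ; zero; suc)
open import Data.Fin using (Fin)
open import Data.Vec using (Vec; []; _∷_; lookup; tabulate; map)
open import Data.List using (List)
open import Data.List.Membership.Propositional using (_∈_)
open import Data.List.Relation.Unary.Unique.Propositional using (Unique)
open import Data.Product using (Σ; ∃; _×_; _,_)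
open import Relation.Nullary using (¬_)
open import Relation.Binary.PropositionalEquality using (_≡_; _≢_)
open import Algebra.Structures using (IsCommutativeRing)

record FiniteField : Set₁ where
  field
    Carrier : Set
    _+_ _*_ : Carrier → Carrier → Carrier
    -_ _⁻¹ : Carrier → Carrier
    0# 1# : Carrier
    isCommutativeRing : IsCommutativeRing _≡_ _+_ _*_ -_ 0# 1#
    0≢1 : 0# ≢ 1#
    inverseʳ : ∀ x → x ≢ 0# → x * (x ⁻¹) ≡ 1#
    elements : List Carrier
    elements-unique : Unique elements
    elements-complete : ∀ x → x ∈ elements

  infixl 6 _+_
  infixl 7 _*_

card : FiniteField → ℕ
card F = Data.List.length (FiniteField.elements F)

module Geometry (F : FiniteField) (q : ℕ) where
  open FiniteField F

  _^_ : Carrier → ℕ → Carrier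
  x ^ zero = 1#
  x ^ suc n = x * (x ^ n)
  infixr 8 _^_

  2# : Carrier
  2# = 1# + 1#

  -- the subfield F_q of F_{q^2}: fixed points of the Frobenius x ↦ x^q
  InFq : Carrier → Set
  InFq x = x ^ q ≡ x

  NonzeroSquareFq : Carrier → Set
  NonzeroSquareFq ρ = InFq ρ × ρ ≢ 0# × ∃ λ t → InFq t × t * t ≡ ρ

  NonSquareFq : Carrier → Set
  NonSquareFq μ = InFq μ × ¬ (∃ λ t → InFq t × t * t ≡ μ)

  V4 : Set
  V4 = Vec Carrier 4

  Mat : Set
  Mat = Vec V4 4

  dot : ∀ {n} → Vec Carrier n → Vec Carrier n → Carrier
  dot [] [] = 0#
  dot (a ∷ u) (b ∷ v) = a * b + dot u v

  -- x ↦ A x (points as column vectors)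
  _·_ : Mat → V4 → V4
  A · x = map (λ row → dot row x) A

  column : Mat → Fin 4 → V4
  column B j = map (λ row → lookup row j) B

  _⊗_ : Mat → Mat → Mat
  A ⊗ B = tabulate λ i → tabulate λ j → dot (lookup A i) (column B j)

  _•_ : Carrier → Mat → Mat
  c • A = map (map (c *_)) A

  _⊙_ : Carrier → V4 → V4
  c ⊙ x = map (c *_) x

  _⊕_ : V4 → V4 → V4
  (a ∷ b ∷ c ∷ d ∷ []) ⊕ (a' ∷ b' ∷ c' ∷ d' ∷ []) =
    (a + a') ∷ (b + b') ∷ (c + c') ∷ (d + d') ∷ []

  I₄ : Mat
  I₄ = (1# ∷ 0# ∷ 0# ∷ 0# ∷ []) ∷ (0# ∷ 1# ∷ 0# ∷ 0# ∷ []) ∷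
       (0# ∷ 0# ∷ 1# ∷ 0# ∷ []) ∷ (0# ∷ 0# ∷ 0# ∷ 1# ∷ []) ∷ []

  mpow : Mat → ℕ → Mat
  mpow A zero = I₄
  mpow A (suc n) = A ⊗ mpow A n

  -- equality of collineations: matrices equal up to a nonzero scalar
  ProjEq : Mat → Mat → Set
  ProjEq A B = ∃ λ c → c ≢ 0# × A ≡ c • B

  T : Carrier → Mat
  T α = (1# ∷ 0# ∷ 0# ∷ 0# ∷ []) ∷ (0# ∷ 1# ∷ 0# ∷ 0# ∷ []) ∷
        (α ∷ 0# ∷ 1# ∷ 0# ∷ []) ∷ (α * α ∷ 0# ∷ 2# * α ∷ 1# ∷ []) ∷ []

  M : Carrier → Mat
  M ρ = (ρ ⁻¹ ∷ 0# ∷ 0# ∷ 0# ∷ []) ∷ (0# ∷ 1# ∷ 0# ∷ 0# ∷ []) ∷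
        (0# ∷ 0# ∷ 1# ∷ 0# ∷ []) ∷ (0# ∷ 0# ∷ 0# ∷ ρ ∷ []) ∷ []

  L : Carrier → Mat
  L λ' = (1# ∷ 0# ∷ 0# ∷ 0# ∷ []) ∷ (0# ∷ λ' ∷ 0# ∷ 0# ∷ []) ∷
         (0# ∷ 0# ∷ 1# ∷ 0# ∷ []) ∷ (0# ∷ 0# ∷ 0# ∷ 1# ∷ []) ∷ []

  N : Carrier → Mat
  N σ = (0# ∷ 0# ∷ 0# ∷ 1# ∷ []) ∷ (0# ∷ σ ∷ 0# ∷ 0# ∷ []) ∷
        (0# ∷ 0# ∷ 1# ∷ 0# ∷ []) ∷ (1# ∷ 0# ∷ 0# ∷ 0# ∷ []) ∷ []

  R : Carrier → Mat
  R μ = (0# ∷ 0# ∷ 0# ∷ μ ⁻¹ ∷ []) ∷ (0# ∷ 1# ∷ 0# ∷ 0# ∷ []) ∷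
        (0# ∷ 0# ∷ 1# ∷ 0# ∷ []) ∷ (μ ∷ 0# ∷ 0# ∷ 0# ∷ []) ∷ []

  half : ℕ
  half = (q ℕ.+ 1) ℕ./ 2

  -- 𝔊: the group generated by the collineations above.  A matrix is in 𝔊 iff
  -- it represents (up to a nonzero scalar) an element of the generated group.
  data InG : Mat → Set where
    gT : ∀ {α} → InFq α → InG (T α)
    gM : ∀ {ρ} → NonzeroSquareFq ρ → InG (M ρ)
    gL : ∀ {λ'} → λ' ^ half ≡ 1# → InG (L λ')
    gN : ∀ {σ} → σ ^ half ≡ - 1# → InG (N σ)
    gR : ∀ {μ} → NonSquareFq μ → InG (R μ)
    gMul : ∀ {A B} → InG A → InG B → InG (A ⊗ B)
    gInv : ∀ {A B} → InG A → ProjEq (A ⊗ B) I₄ → InG B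
    gProj : ∀ {A B} → InG A → ProjEq B A → InG B

  module _ (p : ℕ) where
    data InH : Mat → Set where
      hP : ∀ {A} → InG A → (∃ λ m → ProjEq (mpow A (p ℕ.^ m)) I₄) → InH A
      hL : ∀ {λ'} → λ' ^ half ≡ 1# → InH (L λ')
      hMul : ∀ {A B} → InH A → InH B → InH (A ⊗ B)
      hInv : ∀ {A B} → InH A → ProjEq (A ⊗ B) I₄ → InH B
      hProj : ∀ {A B} → InH A → ProjEq B A → InH B

  OnU3 : V4 → Set
  OnU3 (x0 ∷ x1 ∷ x2 ∷ x3 ∷ []) =
    x1 ^ (q ℕ.+ 1) + 2# * x2 ^ (q ℕ.+ 1) ≡ x3 ^ q * x0 + x3 * x0 ^ q

  OnLine : V4 → V4 → V4 → Set
  OnLine u v x = ∃ λ a → ∃ λ b → x ≡ (a ⊙ u) ⊕ (b ⊙ v)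

  IsGenerator : V4 → V4 → Set
  IsGenerator u v = ∀ x → OnLine u v x → OnU3 x

  MapsLineOnto : Mat → V4 → V4 → V4 → V4 → Set
  MapsLineOnto A u v u' v' =
    (∀ x → OnLine u v x → OnLine u' v' (A · x)) ×
    (∀ y → OnLine u' v' y → ∃ λ x → OnLine u v x × A · x ≡ y)

  SameHOrbit : ℕ → V4 → V4 → V4 → V4 → Set
  SameHOrbit p u v u' v' = ∃ λ A → InH p A × MapsLineOnto A u v u' v'

-- The group 𝔊 acts on the coordinate X₁ by scalars and on X₀, X₂, X₃ by similitudes of the
-- conic Q = X₂² − X₀X₃.  For such a matrix A, acting on X₁ by c, with multiplier k and with
-- determinant δ A on the coordinates X₀, X₂, X₃, the quantity χ A = (δ A / (c k)) ^ ((q+1)/2)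
-- is multiplicative and χ A ² = 1 on 𝔊.  It is 1 on the matrices L λ and on every matrix of odd
-- order modulo scalars, such as the p-elements, hence on all of 𝔥.  A similitude mapping ℓ⁺ onto
-- ℓ⁻ fixes O and is triangular on the conic block, with diagonal a₀₀, − c, a₃₃ where a₀₀ a₃₃ = k;
-- so δ A = − c k and χ A = (−1) ^ ((q+1)/2) = −1 ≠ 1, as q ≡ 1 (mod 4) makes (q+1)/2 odd
-- and the field has odd order q².
-- The lines themselves are generators because (± s) ^ (q+1) = s² = −2.

module Submission where

open import Defs
open import Data.Nat using (ℕ; suc; _%_; _≤_)
open import Data.Nat.Primality using (Prime)
open import Data.Vec using (_∷_; [])
open import Data.Product using (∃; _×_)
open import Relation.Nullary using (¬_)
open import Relation.Binary.PropositionalEquality using (_≡_; _≢_)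

open import Algebra.Bundles using (CommutativeRing; RawRing)
open import Data.Empty using (⊥; ⊥-elim)
open import Data.Fin using (Fin)
open import Data.Fin.Patterns using (0F; 1F; 2F; 3F)
import Data.Integer as ℤ
import Data.Nat as ℕ
open import Data.Nat using (zero)
import Data.Nat.Properties as ℕₚ
open import Data.Product using (∃-syntax; _,_; proj₁; proj₂)
open import Data.Sum using (_⊎_; inj₁; inj₂)
open import Data.Vec using (Vec; lookup; tabulate; map)
open import Data.Vec.Properties using (tabulate-cong; tabulate-∘; tabulate∘lookup; map-cong; map-∘; map-id; lookup-map)
open import Function using (_∘_)
open import Relation.Binary.PropositionalEquality as ≡
  using (refl; sym; trans; cong; cong₂; subst; subst₂; module ≡-Reasoning)

commutativeRing : FiniteField → CommutativeRing _ _
commutativeRing F = record { isCommutativeRing = FiniteField.isCommutativeRing F }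

-- The library's ring solver with integer coefficients interpreted in R, so that coefficient
-- arithmetic, and with it every cancellation, is decided in ℤ.
module IntegerCoefficientSolver {c ℓ} (R : CommutativeRing c ℓ) where
  open import Algebra.Solver.Ring.AlmostCommutativeRing using (fromCommutativeRing; _-Raw-AlmostCommutative⟶_)
  open import Data.Integer using (ℤ; +_; -[1+_]; _⊖_; sign; ∣_∣; _◃_)
  import Data.Integer.Properties as ℤₚ
  import Data.Maybe as Maybe
  open import Data.Sign as Sign using (Sign)
  open import Relation.Binary.Consequences using (dec⇒weaklyDec)

  module R = CommutativeRing R
  open R hiding (refl; sym; trans; reflexive; setoid)
  open import Algebra.Properties.Ring ring
    using (-‿involutive; -0#≈0#; -1*x≈-x; -‿+-comm; -‿distribʳ-*)
  open import Algebra.Properties.Semiring.Mult.TCOptimised semiring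
    using (1+×; ×-homo-+; ×1-homo-*) renaming (_×_ to _×′_)
  open import Algebra.Properties.CommutativeSemigroup +-commutativeSemigroup
    using () renaming (interchange to +-interchange)
  open import Algebra.Properties.CommutativeSemigroup *-commutativeSemigroup
    using () renaming (interchange to *-interchange)
  open import Relation.Binary.Reasoning.Setoid R.setoid

  ⟦_⟧ℤ : ℤ → Carrier
  ⟦ + n ⟧ℤ = n ×′ 1#
  ⟦ -[1+ n ] ⟧ℤ = - (suc n ×′ 1#)

  ⟦⊖⟧ : ∀ m n → ⟦ m ⊖ n ⟧ℤ ≈ m ×′ 1# + - (n ×′ 1#)
  ⟦⊖⟧ m zero = begin
    m ×′ 1#            ≈⟨ +-identityʳ _ ⟨
    m ×′ 1# + 0#       ≈⟨ +-congˡ -0#≈0# ⟨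
    m ×′ 1# + - 0#     ∎
  ⟦⊖⟧ zero (suc n) = R.sym (+-identityˡ _)
  ⟦⊖⟧ (suc m) (suc n) = begin
    ⟦ suc m ⊖ suc n ⟧ℤ                ≈⟨ R.reflexive (cong ⟦_⟧ℤ (ℤₚ.[1+m]⊖[1+n]≡m⊖n m n)) ⟩
    ⟦ m ⊖ n ⟧ℤ                        ≈⟨ ⟦⊖⟧ m n ⟩
    m ×′ 1# + - (n ×′ 1#)               ≈⟨ shift (m ×′ 1#) (n ×′ 1#) ⟩
    (1# + m ×′ 1#) + - (1# + n ×′ 1#)   ≈⟨ +-cong (1+× m 1#) (-‿cong (1+× n 1#)) ⟨
    suc m ×′ 1# + - (suc n ×′ 1#)       ∎
    where
    shift : ∀ x y → x + - y ≈ (1# + x) + - (1# + y)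
    shift x y = begin
      x + - y                   ≈⟨ +-identityˡ _ ⟨
      0# + (x + - y)            ≈⟨ +-congʳ (-‿inverseʳ 1#) ⟨
      (1# + - 1#) + (x + - y)   ≈⟨ +-interchange 1# (- 1#) x (- y) ⟩
      (1# + x) + (- 1# + - y)   ≈⟨ +-congˡ (-‿+-comm 1# y) ⟩
      (1# + x) + - (1# + y)     ∎

  ⟦+⟧ : ∀ i j → ⟦ i ℤ.+ j ⟧ℤ ≈ ⟦ i ⟧ℤ + ⟦ j ⟧ℤ
  ⟦+⟧ (+ m) (+ n) = ×-homo-+ 1# m n
  ⟦+⟧ (+ m) -[1+ n ] = ⟦⊖⟧ m (suc n)
  ⟦+⟧ -[1+ m ] (+ n) = R.trans (⟦⊖⟧ n (suc m)) (+-comm _ _)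
  ⟦+⟧ -[1+ m ] -[1+ n ] = begin
    - (suc (suc (m ℕ.+ n)) ×′ 1#)      ≈⟨ R.reflexive (cong (λ k → - (k ×′ 1#)) (ℕₚ.+-suc (suc m) n)) ⟨
    - ((suc m ℕ.+ suc n) ×′ 1#)        ≈⟨ -‿cong (×-homo-+ 1# (suc m) (suc n)) ⟩
    - (suc m ×′ 1# + suc n ×′ 1#)       ≈⟨ -‿+-comm _ _ ⟨
    - (suc m ×′ 1#) + - (suc n ×′ 1#)   ∎

  ⟦-⟧ : ∀ i → ⟦ ℤ.- i ⟧ℤ ≈ - ⟦ i ⟧ℤ
  ⟦-⟧ (+ zero) = R.sym -0#≈0#
  ⟦-⟧ (+ suc n) = R.refl
  ⟦-⟧ -[1+ n ] = R.sym (-‿involutive _)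

  ⟦_⟧± : Sign → Carrier
  ⟦ Sign.+ ⟧± = 1#
  ⟦ Sign.- ⟧± = - 1#

  ⟦*⟧± : ∀ s t → ⟦ s Sign.* t ⟧± ≈ ⟦ s ⟧± * ⟦ t ⟧±
  ⟦*⟧± Sign.+ t = R.sym (*-identityˡ _)
  ⟦*⟧± Sign.- Sign.+ = R.sym (-1*x≈-x 1#)
  ⟦*⟧± Sign.- Sign.- = begin
    1#               ≈⟨ -‿involutive 1# ⟨
    - - 1#           ≈⟨ -‿cong (-1*x≈-x 1#) ⟨
    - (- 1# * 1#)    ≈⟨ -‿distribʳ-* (- 1#) 1# ⟩
    - 1# * - 1#      ∎

  ⟦◃⟧ : ∀ s n → ⟦ s ◃ n ⟧ℤ ≈ ⟦ s ⟧± * (n ×′ 1#)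
  ⟦◃⟧ s zero = R.sym (zeroʳ _)
  ⟦◃⟧ Sign.+ (suc n) = R.sym (*-identityˡ _)
  ⟦◃⟧ Sign.- (suc n) = R.sym (-1*x≈-x _)

  ⟦*⟧ : ∀ i j → ⟦ i ℤ.* j ⟧ℤ ≈ ⟦ i ⟧ℤ * ⟦ j ⟧ℤ
  ⟦*⟧ i j = begin
    ⟦ (sign i Sign.* sign j) ◃ (∣ i ∣ ℕ.* ∣ j ∣) ⟧ℤ              ≈⟨ ⟦◃⟧ _ (∣ i ∣ ℕ.* ∣ j ∣) ⟩
    ⟦ sign i Sign.* sign j ⟧± * ((∣ i ∣ ℕ.* ∣ j ∣) ×′ 1#)          ≈⟨ *-cong (⟦*⟧± (sign i) (sign j)) (×1-homo-* ∣ i ∣ ∣ j ∣) ⟩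
    (⟦ sign i ⟧± * ⟦ sign j ⟧±) * ((∣ i ∣ ×′ 1#) * (∣ j ∣ ×′ 1#))  ≈⟨ *-interchange _ _ _ _ ⟩
    (⟦ sign i ⟧± * (∣ i ∣ ×′ 1#)) * (⟦ sign j ⟧± * (∣ j ∣ ×′ 1#))  ≈⟨ *-cong (sign◃abs i) (sign◃abs j) ⟩
    ⟦ i ⟧ℤ * ⟦ j ⟧ℤ                                              ∎
    where
    sign◃abs : ∀ i → ⟦ sign i ⟧± * (∣ i ∣ ×′ 1#) ≈ ⟦ i ⟧ℤ
    sign◃abs i = R.trans (R.sym (⟦◃⟧ (sign i) ∣ i ∣)) (R.reflexive (cong ⟦_⟧ℤ (ℤₚ.◃-inverse i)))

  ℤ⟶R : ℤ.+-*-rawRing -Raw-AlmostCommutative⟶ fromCommutativeRing R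
  ℤ⟶R = record
    { ⟦_⟧ = ⟦_⟧ℤ ; +-homo = ⟦+⟧ ; *-homo = ⟦*⟧ ; -‿homo = ⟦-⟧ ; 0-homo = R.refl ; 1-homo = R.refl }

  open import Algebra.Solver.Ring ℤ.+-*-rawRing (fromCommutativeRing R) ℤ⟶R
    (λ i j → Maybe.map (λ i≡j → R.reflexive (cong ⟦_⟧ℤ i≡j)) (dec⇒weaklyDec ℤ._≟_ i j)) public
    using (Polynomial; solve; _:=_; _:+_; _:*_; :-_; con)

  polynomialRawRing : ℕ → RawRing _ _
  polynomialRawRing n = record
    { Carrier = Polynomial n ; _≈_ = _≡_ ; _+_ = _:+_ ; _*_ = _:*_ ; -_ = :-_
    ; 0# = con (+ 0) ; 1# = con (+ 1) }

-- The conic Q and the determinant det₃ only see the coordinates X₀, X₂, X₃.  They are defined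
-- over a raw ring so that they serve both for the field and for the solver's syntax.
module Conic {c ℓ} (R : RawRing c ℓ) where
  open RawRing R

  Q : Vec Carrier 4 → Carrier
  Q (x₀ ∷ _ ∷ x₂ ∷ x₃ ∷ []) = x₂ * x₂ + - (x₀ * x₃)

  det₃ : Vec Carrier 4 → Vec Carrier 4 → Vec Carrier 4 → Carrier
  det₃ (u₀ ∷ _ ∷ u₂ ∷ u₃ ∷ []) (v₀ ∷ _ ∷ v₂ ∷ v₃ ∷ []) (w₀ ∷ _ ∷ w₂ ∷ w₃ ∷ []) =
    u₀ * (v₂ * w₃ + - (w₂ * v₃)) + - (v₀ * (u₂ * w₃ + - (w₂ * u₃))) + w₀ * (u₂ * v₃ + - (v₂ * u₃))

module Parity where
  open import Data.Nat using (_+_; _*_; _^_)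
  open import Data.Nat.DivMod using (_/_; m≡m%n+[m/n]*n; m*n/n≡m)
  open import Data.Nat.Tactic.RingSolver using (solve-∀)

  Odd : ℕ → Set
  Odd n = ∃[ j ] n ≡ suc (j + j)

  Even : ℕ → Set
  Even n = ∃[ j ] n ≡ j + j

  even-or-odd : ∀ n → Even n ⊎ Odd n
  even-or-odd zero = inj₁ (0 , refl)
  even-or-odd (suc n) with even-or-odd n
  ... | inj₁ (j , n≡j+j) = inj₂ (j , cong suc n≡j+j)
  ... | inj₂ (j , n≡1+j+j) = inj₁ (suc j , cong suc (trans n≡1+j+j (sym (ℕₚ.+-suc j j))))

  ¬even∧odd : ∀ {n} → Even n → Odd n → ⊥
  ¬even∧odd (i , refl) (j , e) = go i j e
    where
    go : ∀ i j → i + i ≢ suc (j + j)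
    go (suc i) zero e with trans (sym (ℕₚ.+-suc i i)) (ℕₚ.suc-injective e)
    ... | ()
    go (suc i) (suc j) e =
      go i j (ℕₚ.suc-injective (trans (sym (ℕₚ.+-suc i i)) (trans (ℕₚ.suc-injective e) (cong suc (ℕₚ.+-suc j j)))))

  odd-* : ∀ {m n} → Odd m → Odd n → Odd (m * n)
  odd-* (i , refl) (j , refl) = i * j + i * j + i + j , expand i j
    where
    expand : ∀ i j → suc (i + i) * suc (j + j) ≡ suc ((i * j + i * j + i + j) + (i * j + i * j + i + j))
    expand = solve-∀

  odd-^ : ∀ {m} → Odd m → ∀ k → Odd (m ^ k)
  odd-^ m-odd zero = 0 , refl
  odd-^ m-odd (suc k) = odd-* m-odd (odd-^ m-odd k)

  odd-*⇒odd : ∀ m n → Odd (m * n) → Odd m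
  odd-*⇒odd m n mn-odd with even-or-odd m
  ... | inj₂ m-odd = m-odd
  ... | inj₁ (i , refl) = ⊥-elim (¬even∧odd (i * n , ℕₚ.*-distribʳ-+ n i i) mn-odd)

  odd-base : ∀ p k → 1 ℕ.≤ k → Odd (p ^ k) → Odd p
  odd-base p (suc k) _ = odd-*⇒odd p (p ^ k)

  odd-of-%4≡1 : ∀ q → q % 4 ≡ 1 → Odd q × Odd ((q + 1) / 2)
  odd-of-%4≡1 q q%4≡1 = (m + m , q≡) , (m , half≡)
    where
    m : ℕ
    m = q / 4
    q≡ : q ≡ suc ((m + m) + (m + m))
    q≡ = trans (m≡m%n+[m/n]*n q 4) (trans (cong (_+ m * 4) q%4≡1) (lemma m))
      where
      lemma : ∀ m → 1 + m * 4 ≡ suc ((m + m) + (m + m))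
      lemma = solve-∀
    half≡ : (q + 1) / 2 ≡ suc (m + m)
    half≡ = trans (cong (λ n → (n + 1) / 2) q≡) (trans (cong (_/ 2) (lemma m)) (m*n/n≡m (suc (m + m)) 2))
      where
      lemma : ∀ m → suc ((m + m) + (m + m)) + 1 ≡ suc (m + m) * 2
      lemma = solve-∀

module Characteristic (F : FiniteField) where
  open Parity using (Odd)
  open import Data.List using (List; []; _∷_; foldr; length)
  import Data.List as List
  open import Data.List.Membership.Propositional using (_∈_)
  open import Data.List.Membership.Propositional.Properties using (∈-map⁺)
  open import Data.List.Membership.Propositional.Properties.WithK using (unique∧set⇒bag)
  open import Data.List.Relation.Binary.BagAndSetEquality using (∼bag⇒↭)
  open import Data.List.Relation.Binary.Permutation.Propositional using (_↭_; ↭⇒↭ₛ)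
  open import Data.List.Relation.Binary.Permutation.Setoid.Properties using (foldr-commMonoid)
  import Data.List.Relation.Unary.Unique.Propositional.Properties as Unique
  open import Function.Bundles using (mk⇔)
  open FiniteField F
  open CommutativeRing (commutativeRing F)
    using (ring; +-identityˡ; +-identityʳ; +-assoc; -‿inverseʳ; distribʳ; zeroˡ;
           *-identityˡ; +-isCommutativeMonoid; +-commutativeSemigroup; semiring)
  open import Algebra.Properties.Ring ring using (+-cancelˡ)
  open import Algebra.Properties.Semiring.Mult.TCOptimised semiring
    using (1+×; ×-homo-+) renaming (_×_ to _×′_)
  open import Algebra.Properties.CommutativeSemigroup +-commutativeSemigroup
    using () renaming (interchange to +-interchange)
  open ≡-Reasoning

  sum : List Carrier → Carrier
  sum = foldr _+_ 0#

  sum-map-1+ : ∀ xs → sum (List.map (1# +_) xs) ≡ length xs ×′ 1# + sum xs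
  sum-map-1+ [] = sym (+-identityˡ 0#)
  sum-map-1+ (x ∷ xs) = begin
    (1# + x) + sum (List.map (1# +_) xs)   ≡⟨ cong ((1# + x) +_) (sum-map-1+ xs) ⟩
    (1# + x) + (length xs ×′ 1# + sum xs)  ≡⟨ +-interchange 1# x _ _ ⟩
    (1# + length xs ×′ 1#) + (x + sum xs)  ≡⟨ cong (_+ (x + sum xs)) (1+× (length xs) 1#) ⟨
    suc (length xs) ×′ 1# + (x + sum xs)   ∎

  -- Translation by 1# permutes the elements, so it leaves their sum unchanged.
  card×1≡0 : card F ×′ 1# ≡ 0#
  card×1≡0 = begin
    card F ×′ 1#                                   ≡⟨ +-identityʳ _ ⟨
    card F ×′ 1# + 0#                              ≡⟨ cong (card F ×′ 1# +_) (-‿inverseʳ (sum elements)) ⟨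
    card F ×′ 1# + (sum elements + - sum elements) ≡⟨ +-assoc _ _ _ ⟨
    (card F ×′ 1# + sum elements) + - sum elements ≡⟨ cong (_+ - sum elements) (sum-map-1+ elements) ⟨
    sum (List.map (1# +_) elements) + - sum elements
      ≡⟨ cong (_+ - sum elements) (foldr-commMonoid (≡.setoid Carrier) +-isCommutativeMonoid (↭⇒↭ₛ translation)) ⟨
    sum elements + - sum elements                  ≡⟨ -‿inverseʳ _ ⟩
    0#                                             ∎
    where
    1+-injective : ∀ {x y} → 1# + x ≡ 1# + y → x ≡ y
    1+-injective = +-cancelˡ 1# _ _
    1+-surjective : ∀ x → 1# + (- 1# + x) ≡ x
    1+-surjective x = trans (sym (+-assoc _ _ _)) (trans (cong (_+ x) (-‿inverseʳ 1#)) (+-identityˡ x))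
    translation : elements ↭ List.map (1# +_) elements
    translation = ∼bag⇒↭ (unique∧set⇒bag elements-unique (Unique.map⁺ 1+-injective elements-unique)
      (mk⇔ (λ _ → subst (_∈ _) (1+-surjective _) (∈-map⁺ (1# +_) (elements-complete _)))
           (λ _ → elements-complete _)))

  2≢0 : Odd (card F) → 1# + 1# ≢ 0#
  2≢0 (j , card≡) 2≡0 = 0≢1 (sym (begin
    1#                             ≡⟨ +-identityʳ 1# ⟨
    1# + 0#                        ≡⟨ cong (1# +_) (zeroˡ (j ×′ 1#)) ⟨
    1# + 0# * (j ×′ 1#)            ≡⟨ cong (λ z → 1# + z * (j ×′ 1#)) 2≡0 ⟨
    1# + (1# + 1#) * (j ×′ 1#)     ≡⟨ cong (1# +_) (distribʳ _ 1# 1#) ⟩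
    1# + (1# * (j ×′ 1#) + 1# * (j ×′ 1#))
                                   ≡⟨ cong (1# +_) (cong₂ _+_ (*-identityˡ _) (*-identityˡ _)) ⟩
    1# + (j ×′ 1# + j ×′ 1#)       ≡⟨ cong (1# +_) (×-homo-+ 1# j j) ⟨
    1# + (j ℕ.+ j) ×′ 1#           ≡⟨ 1+× (j ℕ.+ j) 1# ⟨
    suc (j ℕ.+ j) ×′ 1#            ≡⟨ cong (_×′ 1#) card≡ ⟨
    card F ×′ 1#                   ≡⟨ card×1≡0 ⟩
    0#                             ∎))

module Collineations (F : FiniteField) (q : ℕ) where
  open Parity
  open FiniteField F
  open Geometry F q

  open CommutativeRing (commutativeRing F)
    using (rawRing; +-identityˡ; +-identityʳ; *-identityˡ; *-identityʳ; *-assoc; *-comm;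
           zeroˡ; zeroʳ; -‿inverseˡ)
  open import Algebra.Properties.Ring (CommutativeRing.ring (commutativeRing F))
    using (-‿involutive; -0#≈0#; -‿distribˡ-*)
  open import Algebra.Properties.CommutativeSemigroup (CommutativeRing.*-commutativeSemigroup (commutativeRing F))
    using () renaming (interchange to *-interchange)
  open IntegerCoefficientSolver (commutativeRing F)
    using (Polynomial; solve; _:=_; _:+_; _:*_; :-_; con; polynomialRawRing)
  open Conic rawRing using (Q; det₃)
  open ≡-Reasoning

  -- Evaluating them gives back the definitions of `Defs` definitionally,
  -- which is what lets `solve` discharge goals stated with the latter.
  module Syntax {n : ℕ} where
    open Conic (polynomialRawRing n) public using () renaming (Q to Qᴾ; det₃ to det₃ᴾ)

    0ᴾ 1ᴾ 2ᴾ : Polynomial n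
    0ᴾ = con (ℤ.+ 0)
    1ᴾ = con (ℤ.+ 1)
    2ᴾ = con (ℤ.+ 2)

    dotᴾ : ∀ {m} → Vec (Polynomial n) m → Vec (Polynomial n) m → Polynomial n
    dotᴾ [] [] = 0ᴾ
    dotᴾ (a ∷ u) (b ∷ v) = a :* b :+ dotᴾ u v

    _·ᴾ_ : Vec (Vec (Polynomial n) 4) 4 → Vec (Polynomial n) 4 → Vec (Polynomial n) 4
    A ·ᴾ x = map (λ row → dotᴾ row x) A

    _⊙ᴾ_ : Polynomial n → Vec (Polynomial n) 4 → Vec (Polynomial n) 4
    t ⊙ᴾ x = map (t :*_) x

    eᴾ : Fin 4 → Vec (Polynomial n) 4
    eᴾ 0F = 1ᴾ ∷ 0ᴾ ∷ 0ᴾ ∷ 0ᴾ ∷ []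
    eᴾ 1F = 0ᴾ ∷ 1ᴾ ∷ 0ᴾ ∷ 0ᴾ ∷ []
    eᴾ 2F = 0ᴾ ∷ 0ᴾ ∷ 1ᴾ ∷ 0ᴾ ∷ []
    eᴾ 3F = 0ᴾ ∷ 0ᴾ ∷ 0ᴾ ∷ 1ᴾ ∷ []

    Tᴾ : Polynomial n → Vec (Vec (Polynomial n) 4) 4
    Tᴾ α = (1ᴾ ∷ 0ᴾ ∷ 0ᴾ ∷ 0ᴾ ∷ []) ∷ (0ᴾ ∷ 1ᴾ ∷ 0ᴾ ∷ 0ᴾ ∷ []) ∷
           (α ∷ 0ᴾ ∷ 1ᴾ ∷ 0ᴾ ∷ []) ∷ (α :* α ∷ 0ᴾ ∷ 2ᴾ :* α ∷ 1ᴾ ∷ []) ∷ []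

    diagᴾ : Polynomial n → Polynomial n → Polynomial n → Vec (Vec (Polynomial n) 4) 4
    diagᴾ a b d = (a ∷ 0ᴾ ∷ 0ᴾ ∷ 0ᴾ ∷ []) ∷ (0ᴾ ∷ b ∷ 0ᴾ ∷ 0ᴾ ∷ []) ∷
                  (0ᴾ ∷ 0ᴾ ∷ 1ᴾ ∷ 0ᴾ ∷ []) ∷ (0ᴾ ∷ 0ᴾ ∷ 0ᴾ ∷ d ∷ []) ∷ []

    Nᴾ : Polynomial n → Vec (Vec (Polynomial n) 4) 4
    Nᴾ σ = (0ᴾ ∷ 0ᴾ ∷ 0ᴾ ∷ 1ᴾ ∷ []) ∷ (0ᴾ ∷ σ ∷ 0ᴾ ∷ 0ᴾ ∷ []) ∷
           (0ᴾ ∷ 0ᴾ ∷ 1ᴾ ∷ 0ᴾ ∷ []) ∷ (1ᴾ ∷ 0ᴾ ∷ 0ᴾ ∷ 0ᴾ ∷ []) ∷ []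

    Rᴾ : Polynomial n → Polynomial n → Vec (Vec (Polynomial n) 4) 4
    Rᴾ μ⁻¹ μ = (0ᴾ ∷ 0ᴾ ∷ 0ᴾ ∷ μ⁻¹ ∷ []) ∷ (0ᴾ ∷ 1ᴾ ∷ 0ᴾ ∷ 0ᴾ ∷ []) ∷
               (0ᴾ ∷ 0ᴾ ∷ 1ᴾ ∷ 0ᴾ ∷ []) ∷ (μ ∷ 0ᴾ ∷ 0ᴾ ∷ 0ᴾ ∷ []) ∷ []

  open Syntax

  1≢0 : 1# ≢ 0#
  1≢0 1≡0 = 0≢1 (sym 1≡0)

  ⁻¹-inverseˡ : ∀ {a} → a ≢ 0# → a ⁻¹ * a ≡ 1#
  ⁻¹-inverseˡ {a} a≢0 = trans (*-comm _ _) (inverseʳ a a≢0)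

  *-cancelˡ : ∀ {a x y} → a ≢ 0# → a * x ≡ a * y → x ≡ y
  *-cancelˡ {a} {x} {y} a≢0 ax≡ay = begin
    x                ≡⟨ *-identityˡ x ⟨
    1# * x           ≡⟨ cong (_* x) (⁻¹-inverseˡ a≢0) ⟨
    (a ⁻¹ * a) * x   ≡⟨ *-assoc _ _ _ ⟩
    a ⁻¹ * (a * x)   ≡⟨ cong (a ⁻¹ *_) ax≡ay ⟩
    a ⁻¹ * (a * y)   ≡⟨ *-assoc _ _ _ ⟨
    (a ⁻¹ * a) * y   ≡⟨ cong (_* y) (⁻¹-inverseˡ a≢0) ⟩
    1# * y           ≡⟨ *-identityˡ y ⟩
    y                ∎

  *-cancelʳ : ∀ {a x y} → a ≢ 0# → x * a ≡ y * a → x ≡ y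
  *-cancelʳ {a} {x} {y} a≢0 xa≡ya = *-cancelˡ a≢0 (trans (*-comm a x) (trans xa≡ya (*-comm y a)))

  *-≢0 : ∀ {a b} → a ≢ 0# → b ≢ 0# → a * b ≢ 0#
  *-≢0 {a} a≢0 b≢0 ab≡0 = b≢0 (*-cancelˡ a≢0 (trans ab≡0 (sym (zeroʳ a))))

  -‿≢0 : ∀ {a} → a ≢ 0# → - a ≢ 0#
  -‿≢0 {a} a≢0 -a≡0 = a≢0 (trans (sym (-‿involutive a)) (trans (cong -_ -a≡0) -0#≈0#))

  -x*-x≡x*x : ∀ x → - x * - x ≡ x * x
  -x*-x≡x*x = solve 1 (λ x → :- x :* :- x := x :* x) refl

  x*x≡-2⇒x≢0 : ∀ {x} → 1# + 1# ≢ 0# → x * x ≡ - (1# + 1#) → x ≢ 0#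
  x*x≡-2⇒x≢0 2≢0 x²≡-2 refl = 2≢0 (trans (sym (-‿involutive _)) (trans (cong -_ (trans (sym x²≡-2) (zeroˡ 0#))) -0#≈0#))

  x≡-x⇒x≡0 : ∀ {x} → 1# + 1# ≢ 0# → x ≡ - x → x ≡ 0#
  x≡-x⇒x≡0 {x} 2≢0 x≡-x = *-cancelˡ 2≢0 (begin
    (1# + 1#) * x   ≡⟨ solve 1 (λ x → 2ᴾ :* x := x :+ x) refl x ⟩
    x + x           ≡⟨ cong (_+ x) x≡-x ⟩
    - x + x         ≡⟨ -‿inverseˡ x ⟩
    0#              ≡⟨ zeroʳ _ ⟨
    (1# + 1#) * 0#  ∎)

  ^-distribʳ-* : ∀ a b n → (a * b) ^ n ≡ a ^ n * b ^ n
  ^-distribʳ-* a b zero = sym (*-identityˡ 1#)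
  ^-distribʳ-* a b (suc n) = begin
    (a * b) * (a * b) ^ n       ≡⟨ cong ((a * b) *_) (^-distribʳ-* a b n) ⟩
    (a * b) * (a ^ n * b ^ n)   ≡⟨ *-interchange a b _ _ ⟩
    (a * a ^ n) * (b * b ^ n)   ∎

  ^-distribˡ-+-* : ∀ a m n → a ^ (m ℕ.+ n) ≡ a ^ m * a ^ n
  ^-distribˡ-+-* a zero n = sym (*-identityˡ _)
  ^-distribˡ-+-* a (suc m) n = trans (cong (a *_) (^-distribˡ-+-* a m n)) (sym (*-assoc _ _ _))

  ^-*-assoc : ∀ a m n → (a ^ m) ^ n ≡ a ^ (m ℕ.* n)
  ^-*-assoc a m zero = cong (a ^_) (sym (ℕₚ.*-zeroʳ m))
  ^-*-assoc a m (suc n) = begin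
    a ^ m * (a ^ m) ^ n       ≡⟨ cong (a ^ m *_) (^-*-assoc a m n) ⟩
    a ^ m * a ^ (m ℕ.* n)     ≡⟨ ^-distribˡ-+-* a m (m ℕ.* n) ⟨
    a ^ (m ℕ.+ m ℕ.* n)       ≡⟨ cong (a ^_) (ℕₚ.*-suc m n) ⟨
    a ^ (m ℕ.* suc n)         ∎

  ^-comm : ∀ a m n → (a ^ m) ^ n ≡ (a ^ n) ^ m
  ^-comm a m n = trans (^-*-assoc a m n) (trans (cong (a ^_) (ℕₚ.*-comm m n)) (sym (^-*-assoc a n m)))

  1^n≡1 : ∀ n → 1# ^ n ≡ 1#
  1^n≡1 zero = refl
  1^n≡1 (suc n) = trans (*-identityˡ _) (1^n≡1 n)

  ^-≢0 : ∀ {a} n → a ≢ 0# → a ^ n ≢ 0#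
  ^-≢0 zero a≢0 = 1≢0
  ^-≢0 (suc n) a≢0 = *-≢0 a≢0 (^-≢0 n a≢0)

  ^-odd : ∀ a j → a ^ suc (j ℕ.+ j) ≡ a * (a * a) ^ j
  ^-odd a j = cong (a *_) (trans (^-distribˡ-+-* a j j) (sym (^-distribʳ-* a a j)))

  0^odd : ∀ {n} → Odd n → 0# ^ n ≡ 0#
  0^odd (j , refl) = zeroˡ _

  -‿^-odd : ∀ a {n} → Odd n → (- a) ^ n ≡ - (a ^ n)
  -‿^-odd a (j , refl) = begin
    (- a) ^ suc (j ℕ.+ j)     ≡⟨ ^-odd (- a) j ⟩
    - a * (- a * - a) ^ j     ≡⟨ cong (λ z → - a * z ^ j) (-x*-x≡x*x a) ⟩
    - a * (a * a) ^ j         ≡⟨ -‿distribˡ-* a _ ⟨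
    - (a * (a * a) ^ j)       ≡⟨ cong -_ (^-odd a j) ⟨
    - (a ^ suc (j ℕ.+ j))     ∎

  ^-odd-injective : ∀ {x y n} → Odd n → x ^ n ≡ y ^ n → x * x ≡ y * y → y ≢ 0# → x ≡ y
  ^-odd-injective {x} {y} (j , refl) xⁿ≡yⁿ x²≡y² y≢0 =
    *-cancelʳ (^-≢0 j (*-≢0 y≢0 y≢0)) (begin
      x * (y * y) ^ j   ≡⟨ cong (λ z → x * z ^ j) x²≡y² ⟨
      x * (x * x) ^ j   ≡⟨ ^-odd x j ⟨
      x ^ suc (j ℕ.+ j) ≡⟨ xⁿ≡yⁿ ⟩
      y ^ suc (j ℕ.+ j) ≡⟨ ^-odd y j ⟩
      y * (y * y) ^ j   ∎)

  e : Fin 4 → V4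
  e 0F = 1# ∷ 0# ∷ 0# ∷ 0# ∷ []
  e 1F = 0# ∷ 1# ∷ 0# ∷ 0# ∷ []
  e 2F = 0# ∷ 0# ∷ 1# ∷ 0# ∷ []
  e 3F = 0# ∷ 0# ∷ 0# ∷ 1# ∷ []

  ≡-V4 : ∀ {a b c d a′ b′ c′ d′ : Carrier} → a ≡ a′ → b ≡ b′ → c ≡ c′ → d ≡ d′ →
         (a ∷ b ∷ c ∷ d ∷ []) ≡ (a′ ∷ b′ ∷ c′ ∷ d′ ∷ [])
  ≡-V4 refl refl refl refl = refl

  dot-tabulate-0 : ∀ {n} (x : Vec Carrier n) → dot (tabulate λ _ → 0#) x ≡ 0#
  dot-tabulate-0 [] = refl
  dot-tabulate-0 (x ∷ xs) = trans (cong₂ _+_ (zeroˡ x) (dot-tabulate-0 xs)) (+-identityˡ 0#)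

  dot-tabulate-+ : ∀ {n} (f g : Fin n → Carrier) x →
                   dot (tabulate λ j → f j + g j) x ≡ dot (tabulate f) x + dot (tabulate g) x
  dot-tabulate-+ f g [] = sym (+-identityˡ 0#)
  dot-tabulate-+ f g (x ∷ xs) = begin
    (f 0F + g 0F) * x + dot (tabulate λ j → f (Fin.suc j) + g (Fin.suc j)) xs
      ≡⟨ cong ((f 0F + g 0F) * x +_) (dot-tabulate-+ (f ∘ Fin.suc) (g ∘ Fin.suc) xs) ⟩
    (f 0F + g 0F) * x + (dot (tabulate (f ∘ Fin.suc)) xs + dot (tabulate (g ∘ Fin.suc)) xs)
      ≡⟨ solve 5 (λ a b x u v → (a :+ b) :* x :+ (u :+ v) := (a :* x :+ u) :+ (b :* x :+ v)) refl _ _ x _ _ ⟩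
    (f 0F * x + dot (tabulate (f ∘ Fin.suc)) xs) + (g 0F * x + dot (tabulate (g ∘ Fin.suc)) xs) ∎

  dot-tabulate-* : ∀ {n} a (f : Fin n → Carrier) x → dot (tabulate λ j → a * f j) x ≡ a * dot (tabulate f) x
  dot-tabulate-* a f [] = sym (zeroʳ a)
  dot-tabulate-* a f (x ∷ xs) = begin
    a * f 0F * x + dot (tabulate λ j → a * f (Fin.suc j)) xs
      ≡⟨ cong (a * f 0F * x +_) (dot-tabulate-* a (λ j → f (Fin.suc j)) xs) ⟩
    a * f 0F * x + a * dot (tabulate λ j → f (Fin.suc j)) xs
      ≡⟨ solve 4 (λ a b x u → a :* b :* x :+ a :* u := a :* (b :* x :+ u)) refl a _ x _ ⟩
    a * (f 0F * x + dot (tabulate λ j → f (Fin.suc j)) xs) ∎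

  dot-columns : ∀ {m n} (u : Vec Carrier n) (B : Vec (Vec Carrier m) n) x →
                dot (tabulate λ j → dot u (map (λ row → lookup row j) B)) x ≡ dot u (map (λ row → dot row x) B)
  dot-columns [] [] x = dot-tabulate-0 x
  dot-columns (a ∷ u) (r ∷ B) x = begin
    dot (tabulate λ j → a * lookup r j + dot u (map (λ row → lookup row j) B)) x
      ≡⟨ dot-tabulate-+ _ _ x ⟩
    dot (tabulate λ j → a * lookup r j) x + dot (tabulate λ j → dot u (map (λ row → lookup row j) B)) x
      ≡⟨ cong₂ _+_ (dot-tabulate-* a (lookup r) x) (dot-columns u B x) ⟩
    a * dot (tabulate (lookup r)) x + dot u (map (λ row → dot row x) B)
      ≡⟨ cong (λ r′ → a * dot r′ x + dot u (map (λ row → dot row x) B)) (tabulate∘lookup r) ⟩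
    a * dot r x + dot u (map (λ row → dot row x) B) ∎

  ·-⊗ : ∀ A B x → (A ⊗ B) · x ≡ A · (B · x)
  ·-⊗ A B x = begin
    map (λ row → dot row x) (tabulate λ i → tabulate λ j → dot (lookup A i) (column B j))
      ≡⟨ tabulate-∘ (λ row → dot row x) (λ i → tabulate λ j → dot (lookup A i) (column B j)) ⟨
    tabulate (λ i → dot (tabulate λ j → dot (lookup A i) (column B j)) x)
      ≡⟨ tabulate-cong (λ i → dot-columns (lookup A i) B x) ⟩
    tabulate (λ i → dot (lookup A i) (B · x))
      ≡⟨ tabulate-∘ (λ row → dot row (B · x)) (lookup A) ⟩
    map (λ row → dot row (B · x)) (tabulate (lookup A))
      ≡⟨ cong (map (λ row → dot row (B · x))) (tabulate∘lookup A) ⟩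
    A · (B · x) ∎

  dot-⊙ʳ : ∀ {n} t (u v : Vec Carrier n) → dot u (map (t *_) v) ≡ t * dot u v
  dot-⊙ʳ t [] [] = sym (zeroʳ t)
  dot-⊙ʳ t (a ∷ u) (x ∷ v) = trans (cong (a * (t * x) +_) (dot-⊙ʳ t u v))
    (solve 4 (λ t a x w → a :* (t :* x) :+ t :* w := t :* (a :* x :+ w)) refl t a x _)

  dot-⊙ˡ : ∀ {n} t (u v : Vec Carrier n) → dot (map (t *_) u) v ≡ t * dot u v
  dot-⊙ˡ t [] [] = sym (zeroʳ t)
  dot-⊙ˡ t (a ∷ u) (x ∷ v) = trans (cong (t * a * x +_) (dot-⊙ˡ t u v))
    (solve 4 (λ t a x w → t :* a :* x :+ t :* w := t :* (a :* x :+ w)) refl t a x _)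

  ·-⊙ : ∀ A t x → A · (t ⊙ x) ≡ t ⊙ (A · x)
  ·-⊙ A t x = trans (map-cong (λ row → dot-⊙ʳ t row x) A) (map-∘ (t *_) (λ row → dot row x) A)

  •-· : ∀ t A x → (t • A) · x ≡ t ⊙ (A · x)
  •-· t A x = begin
    map (λ row → dot row x) (map (map (t *_)) A)   ≡⟨ map-∘ _ _ A ⟨
    map (λ row → dot (map (t *_) row) x) A          ≡⟨ map-cong (λ row → dot-⊙ˡ t row x) A ⟩
    map (λ row → t * dot row x) A                   ≡⟨ map-∘ (t *_) (λ row → dot row x) A ⟩
    t ⊙ (A · x)                                     ∎

  ⊙-⊙ : ∀ s t x → s ⊙ (t ⊙ x) ≡ (s * t) ⊙ x
  ⊙-⊙ s t x = trans (sym (map-∘ (s *_) (t *_) x)) (map-cong (λ y → sym (*-assoc s t y)) x)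

  1⊙ : ∀ x → 1# ⊙ x ≡ x
  1⊙ x = trans (map-cong *-identityˡ x) (map-id x)


  -- M ρ = diag (ρ ⁻¹) 1# ρ, L λ = diag 1# λ 1# and I₄ = diag 1# 1# 1# hold definitionally.
  diag : Carrier → Carrier → Carrier → Mat
  diag a b d = (a ∷ 0# ∷ 0# ∷ 0# ∷ []) ∷ (0# ∷ b ∷ 0# ∷ 0# ∷ []) ∷
               (0# ∷ 0# ∷ 1# ∷ 0# ∷ []) ∷ (0# ∷ 0# ∷ 0# ∷ d ∷ []) ∷ []

  dot-e : ∀ i x → dot (e i) x ≡ lookup x i
  dot-e 0F (x₀ ∷ x₁ ∷ x₂ ∷ x₃ ∷ []) = solve 4 (λ x₀ x₁ x₂ x₃ → dotᴾ (eᴾ 0F) (x₀ ∷ x₁ ∷ x₂ ∷ x₃ ∷ []) := x₀) refl x₀ x₁ x₂ x₃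
  dot-e 1F (x₀ ∷ x₁ ∷ x₂ ∷ x₃ ∷ []) = solve 4 (λ x₀ x₁ x₂ x₃ → dotᴾ (eᴾ 1F) (x₀ ∷ x₁ ∷ x₂ ∷ x₃ ∷ []) := x₁) refl x₀ x₁ x₂ x₃
  dot-e 2F (x₀ ∷ x₁ ∷ x₂ ∷ x₃ ∷ []) = solve 4 (λ x₀ x₁ x₂ x₃ → dotᴾ (eᴾ 2F) (x₀ ∷ x₁ ∷ x₂ ∷ x₃ ∷ []) := x₂) refl x₀ x₁ x₂ x₃
  dot-e 3F (x₀ ∷ x₁ ∷ x₂ ∷ x₃ ∷ []) = solve 4 (λ x₀ x₁ x₂ x₃ → dotᴾ (eᴾ 3F) (x₀ ∷ x₁ ∷ x₂ ∷ x₃ ∷ []) := x₃) refl x₀ x₁ x₂ x₃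

  dot-comm : ∀ {m} (u v : Vec Carrier m) → dot u v ≡ dot v u
  dot-comm [] [] = refl
  dot-comm (a ∷ u) (b ∷ v) = cong₂ _+_ (*-comm a b) (dot-comm u v)

  ≡-by-dot : ∀ {u v : V4} → (∀ y → dot y u ≡ dot y v) → u ≡ v
  ≡-by-dot {u} {v} h = begin
    u                                                      ≡⟨ lookups u ⟨
    lookup u 0F ∷ lookup u 1F ∷ lookup u 2F ∷ lookup u 3F ∷ []
      ≡⟨ ≡-V4 (component 0F) (component 1F) (component 2F) (component 3F) ⟩
    lookup v 0F ∷ lookup v 1F ∷ lookup v 2F ∷ lookup v 3F ∷ [] ≡⟨ lookups v ⟩
    v                                                      ∎
    where
    lookups : ∀ (x : V4) → (lookup x 0F ∷ lookup x 1F ∷ lookup x 2F ∷ lookup x 3F ∷ []) ≡ x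
    lookups (_ ∷ _ ∷ _ ∷ _ ∷ []) = refl
    component : ∀ i → lookup u i ≡ lookup v i
    component i = trans (sym (dot-e i u)) (trans (h (e i)) (dot-e i v))

  ·-e : ∀ A i → A · e i ≡ column A i
  ·-e A i = map-cong (λ row → trans (dot-comm row (e i)) (dot-e i row)) A

  I₄-· : ∀ x → I₄ · x ≡ x
  I₄-· (x₀ ∷ x₁ ∷ x₂ ∷ x₃ ∷ []) = ≡-by-dot λ where
    (y₀ ∷ y₁ ∷ y₂ ∷ y₃ ∷ []) → solve 8 (λ x₀ x₁ x₂ x₃ y₀ y₁ y₂ y₃ →
      let x = x₀ ∷ x₁ ∷ x₂ ∷ x₃ ∷ [] ; y = y₀ ∷ y₁ ∷ y₂ ∷ y₃ ∷ []
      in dotᴾ y (diagᴾ 1ᴾ 1ᴾ 1ᴾ ·ᴾ x) := dotᴾ y x) refl x₀ x₁ x₂ x₃ y₀ y₁ y₂ y₃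

  -- Block similitudes of the conic
  -- A acts on X₁ as the scalar c, and on X₀, X₂, X₃ as a similitude of Q with multiplier k.
  record Similitude (A : Mat) : Set where
    field
      c k : Carrier
      row₁ : ∀ x → lookup (A · x) 1F ≡ c * lookup x 1F
      column₁ : A · e 1F ≡ c ⊙ e 1F
      Q-∘ : ∀ x → Q (A · x) ≡ k * Q x

  block-similitude : ∀ {A c k} → lookup A 1F ≡ (0# ∷ c ∷ 0# ∷ 0# ∷ []) → column A 1F ≡ (0# ∷ c ∷ 0# ∷ 0# ∷ []) →
                     (∀ x → Q (A · x) ≡ k * Q x) → Similitude A
  block-similitude {A} {c} {k} row≡ column≡ Q-∘ = record
    { c = c ; k = k ; Q-∘ = Q-∘
    ; row₁ = λ x → trans (lookup-map 1F (λ row → dot row x) A) (trans (cong (λ r → dot r x) row≡) (dot-row₁ x))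
    ; column₁ = trans (·-e A 1F) (trans column≡ (≡-V4 (sym (zeroʳ c)) (sym (*-identityʳ c)) (sym (zeroʳ c)) (sym (zeroʳ c))))
    }
    where
    dot-row₁ : ∀ x → dot (0# ∷ c ∷ 0# ∷ 0# ∷ []) x ≡ c * lookup x 1F
    dot-row₁ (x₀ ∷ x₁ ∷ x₂ ∷ x₃ ∷ []) =
      solve 5 (λ c x₀ x₁ x₂ x₃ → dotᴾ (0ᴾ ∷ c ∷ 0ᴾ ∷ 0ᴾ ∷ []) (x₀ ∷ x₁ ∷ x₂ ∷ x₃ ∷ []) := c :* x₁) refl c x₀ x₁ x₂ x₃

  Rescaling : Carrier → Mat → Mat → Set
  Rescaling t A B = ∀ x → B · x ≡ t ⊙ (A · x)

  Q-⊙ : ∀ t x → Q (t ⊙ x) ≡ (t * t) * Q x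
  Q-⊙ t (x₀ ∷ x₁ ∷ x₂ ∷ x₃ ∷ []) = solve 5 (λ t x₀ x₁ x₂ x₃ →
    Qᴾ (t ⊙ᴾ (x₀ ∷ x₁ ∷ x₂ ∷ x₃ ∷ [])) := (t :* t) :* Qᴾ (x₀ ∷ x₁ ∷ x₂ ∷ x₃ ∷ [])) refl t x₀ x₁ x₂ x₃

  similitude-rescale : ∀ {t A B} → Rescaling t A B → Similitude A → Similitude B
  similitude-rescale {t} {A} {B} B≡tA sim = record
    { c = t * c ; k = (t * t) * k
    ; row₁ = λ x → begin
        lookup (B · x) 1F         ≡⟨ cong (λ v → lookup v 1F) (B≡tA x) ⟩
        lookup (t ⊙ (A · x)) 1F   ≡⟨ lookup-map 1F (t *_) (A · x) ⟩
        t * lookup (A · x) 1F     ≡⟨ cong (t *_) (row₁ x) ⟩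
        t * (c * lookup x 1F)     ≡⟨ *-assoc t c _ ⟨
        (t * c) * lookup x 1F     ∎
    ; column₁ = begin
        B · e 1F           ≡⟨ B≡tA (e 1F) ⟩
        t ⊙ (A · e 1F)     ≡⟨ cong (t ⊙_) column₁ ⟩
        t ⊙ (c ⊙ e 1F)     ≡⟨ ⊙-⊙ t c (e 1F) ⟩
        (t * c) ⊙ e 1F     ∎
    ; Q-∘ = λ x → begin
        Q (B · x)                 ≡⟨ cong Q (B≡tA x) ⟩
        Q (t ⊙ (A · x))           ≡⟨ Q-⊙ t (A · x) ⟩
        (t * t) * Q (A · x)       ≡⟨ cong ((t * t) *_) (Q-∘ x) ⟩
        (t * t) * (k * Q x)       ≡⟨ *-assoc _ k _ ⟨
        ((t * t) * k) * Q x       ∎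
    }
    where open Similitude sim

  similitude-⊗ : ∀ {A B} → Similitude A → Similitude B → Similitude (A ⊗ B)
  similitude-⊗ {A} {B} simA simB = record
    { c = A.c * B.c ; k = A.k * B.k
    ; row₁ = λ x → begin
        lookup ((A ⊗ B) · x) 1F     ≡⟨ cong (λ v → lookup v 1F) (·-⊗ A B x) ⟩
        lookup (A · (B · x)) 1F     ≡⟨ A.row₁ (B · x) ⟩
        A.c * lookup (B · x) 1F     ≡⟨ cong (A.c *_) (B.row₁ x) ⟩
        A.c * (B.c * lookup x 1F)   ≡⟨ *-assoc _ _ _ ⟨
        (A.c * B.c) * lookup x 1F   ∎
    ; column₁ = begin
        (A ⊗ B) · e 1F        ≡⟨ ·-⊗ A B (e 1F) ⟩
        A · (B · e 1F)        ≡⟨ cong (A ·_) B.column₁ ⟩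
        A · (B.c ⊙ e 1F)      ≡⟨ ·-⊙ A B.c (e 1F) ⟩
        B.c ⊙ (A · e 1F)      ≡⟨ cong (B.c ⊙_) A.column₁ ⟩
        B.c ⊙ (A.c ⊙ e 1F)    ≡⟨ ⊙-⊙ B.c A.c (e 1F) ⟩
        (B.c * A.c) ⊙ e 1F    ≡⟨ cong (_⊙ e 1F) (*-comm B.c A.c) ⟩
        (A.c * B.c) ⊙ e 1F    ∎
    ; Q-∘ = λ x → begin
        Q ((A ⊗ B) · x)       ≡⟨ cong Q (·-⊗ A B x) ⟩
        Q (A · (B · x))       ≡⟨ A.Q-∘ (B · x) ⟩
        A.k * Q (B · x)       ≡⟨ cong (A.k *_) (B.Q-∘ x) ⟩
        A.k * (B.k * Q x)     ≡⟨ *-assoc _ _ _ ⟨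
        (A.k * B.k) * Q x     ∎
    }
    where
    module A = Similitude simA
    module B = Similitude simB

  I₄-similitude : Similitude I₄
  I₄-similitude = block-similitude refl refl λ x → trans (cong Q (I₄-· x)) (sym (*-identityˡ (Q x)))

  cong₃ : ∀ (f : V4 → V4 → V4 → Carrier) {u u′ v v′ w w′} → u ≡ u′ → v ≡ v′ → w ≡ w′ → f u v w ≡ f u′ v′ w′
  cong₃ f refl refl refl = refl

  δ ν : Mat → Carrier
  δ A = det₃ (A · e 0F) (A · e 2F) (A · e 3F)
  ν A = lookup (A · e 1F) 1F * Q (A · e 2F)

  det₃-· : ∀ A u v w → lookup u 1F ≡ 0# → lookup v 1F ≡ 0# → lookup w 1F ≡ 0# →
           det₃ (A · u) (A · v) (A · w) ≡ δ A * det₃ u v w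
  det₃-· ((a₀₀ ∷ a₀₁ ∷ a₀₂ ∷ a₀₃ ∷ []) ∷ (a₁₀ ∷ a₁₁ ∷ a₁₂ ∷ a₁₃ ∷ []) ∷
          (a₂₀ ∷ a₂₁ ∷ a₂₂ ∷ a₂₃ ∷ []) ∷ (a₃₀ ∷ a₃₁ ∷ a₃₂ ∷ a₃₃ ∷ []) ∷ [])
         (u₀ ∷ _ ∷ u₂ ∷ u₃ ∷ []) (v₀ ∷ _ ∷ v₂ ∷ v₃ ∷ []) (w₀ ∷ _ ∷ w₂ ∷ w₃ ∷ []) refl refl refl =
    solve 25 (λ a₀₀ a₀₁ a₀₂ a₀₃ a₁₀ a₁₁ a₁₂ a₁₃ a₂₀ a₂₁ a₂₂ a₂₃ a₃₀ a₃₁ a₃₂ a₃₃ u₀ u₂ u₃ v₀ v₂ v₃ w₀ w₂ w₃ →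
      let A = (a₀₀ ∷ a₀₁ ∷ a₀₂ ∷ a₀₃ ∷ []) ∷ (a₁₀ ∷ a₁₁ ∷ a₁₂ ∷ a₁₃ ∷ []) ∷
              (a₂₀ ∷ a₂₁ ∷ a₂₂ ∷ a₂₃ ∷ []) ∷ (a₃₀ ∷ a₃₁ ∷ a₃₂ ∷ a₃₃ ∷ []) ∷ []
          u = u₀ ∷ 0ᴾ ∷ u₂ ∷ u₃ ∷ [] ; v = v₀ ∷ 0ᴾ ∷ v₂ ∷ v₃ ∷ [] ; w = w₀ ∷ 0ᴾ ∷ w₂ ∷ w₃ ∷ []
      in det₃ᴾ (A ·ᴾ u) (A ·ᴾ v) (A ·ᴾ w)
           := det₃ᴾ (A ·ᴾ eᴾ 0F) (A ·ᴾ eᴾ 2F) (A ·ᴾ eᴾ 3F) :* det₃ᴾ u v w)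
      refl a₀₀ a₀₁ a₀₂ a₀₃ a₁₀ a₁₁ a₁₂ a₁₃ a₂₀ a₂₁ a₂₂ a₂₃ a₃₀ a₃₁ a₃₂ a₃₃ u₀ u₂ u₃ v₀ v₂ v₃ w₀ w₂ w₃

  det₃-⊙ : ∀ t u v w → det₃ (t ⊙ u) (t ⊙ v) (t ⊙ w) ≡ (t * (t * t)) * det₃ u v w
  det₃-⊙ t (u₀ ∷ u₁ ∷ u₂ ∷ u₃ ∷ []) (v₀ ∷ v₁ ∷ v₂ ∷ v₃ ∷ []) (w₀ ∷ w₁ ∷ w₂ ∷ w₃ ∷ []) =
    solve 13 (λ t u₀ u₁ u₂ u₃ v₀ v₁ v₂ v₃ w₀ w₁ w₂ w₃ →
      let u = u₀ ∷ u₁ ∷ u₂ ∷ u₃ ∷ [] ; v = v₀ ∷ v₁ ∷ v₂ ∷ v₃ ∷ [] ; w = w₀ ∷ w₁ ∷ w₂ ∷ w₃ ∷ []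
      in det₃ᴾ (t ⊙ᴾ u) (t ⊙ᴾ v) (t ⊙ᴾ w) := (t :* (t :* t)) :* det₃ᴾ u v w)
      refl t u₀ u₁ u₂ u₃ v₀ v₁ v₂ v₃ w₀ w₁ w₂ w₃

  δ-⊗ : ∀ A {B} → Similitude B → δ (A ⊗ B) ≡ δ A * δ B
  δ-⊗ A {B} simB = begin
    det₃ ((A ⊗ B) · e 0F) ((A ⊗ B) · e 2F) ((A ⊗ B) · e 3F)
      ≡⟨ cong₃ det₃ (·-⊗ A B (e 0F)) (·-⊗ A B (e 2F)) (·-⊗ A B (e 3F)) ⟩
    det₃ (A · (B · e 0F)) (A · (B · e 2F)) (A · (B · e 3F))
      ≡⟨ det₃-· A (B · e 0F) (B · e 2F) (B · e 3F) (off-axis refl) (off-axis refl) (off-axis refl) ⟩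
    δ A * δ B ∎
    where
    off-axis : ∀ {x} → lookup x 1F ≡ 0# → lookup (B · x) 1F ≡ 0#
    off-axis x₁≡0 = trans (Similitude.row₁ simB _) (trans (cong (_ *_) x₁≡0) (zeroʳ _))

  ν-similitude : ∀ {A} (sim : Similitude A) → ν A ≡ Similitude.c sim * Similitude.k sim
  ν-similitude sim = cong₂ _*_ (trans (row₁ (e 1F)) (*-identityʳ c)) (trans (Q-∘ (e 2F)) Q-e₂)
    where
    open Similitude sim
    Q-e₂ : k * Q (e 2F) ≡ k
    Q-e₂ = solve 1 (λ k → k :* Qᴾ (eᴾ 2F) := k) refl k

  ν-⊗ : ∀ {A B} → Similitude A → Similitude B → ν (A ⊗ B) ≡ ν A * ν B
  ν-⊗ {A} {B} simA simB = begin
    ν (A ⊗ B)                 ≡⟨ ν-similitude (similitude-⊗ simA simB) ⟩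
    (A.c * B.c) * (A.k * B.k) ≡⟨ *-interchange A.c B.c A.k B.k ⟩
    (A.c * A.k) * (B.c * B.k) ≡⟨ cong₂ _*_ (ν-similitude simA) (ν-similitude simB) ⟨
    ν A * ν B                 ∎
    where
    module A = Similitude simA
    module B = Similitude simB

  δ-rescale : ∀ {t A B} → Rescaling t A B → δ B ≡ (t * (t * t)) * δ A
  δ-rescale {t} {A} {B} B≡tA = begin
    det₃ (B · e 0F) (B · e 2F) (B · e 3F)
      ≡⟨ cong₃ det₃ (B≡tA (e 0F)) (B≡tA (e 2F)) (B≡tA (e 3F)) ⟩
    det₃ (t ⊙ (A · e 0F)) (t ⊙ (A · e 2F)) (t ⊙ (A · e 3F))
      ≡⟨ det₃-⊙ t (A · e 0F) (A · e 2F) (A · e 3F) ⟩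
    (t * (t * t)) * δ A ∎

  ν-rescale : ∀ {t A B} → Rescaling t A B → Similitude A → ν B ≡ (t * (t * t)) * ν A
  ν-rescale {t} {A} {B} B≡tA simA = begin
    ν B                                   ≡⟨ ν-similitude (similitude-rescale B≡tA simA) ⟩
    (t * A.c) * ((t * t) * A.k)           ≡⟨ solve 3 (λ t c k → (t :* c) :* ((t :* t) :* k) := (t :* (t :* t)) :* (c :* k)) refl t A.c A.k ⟩
    (t * (t * t)) * (A.c * A.k)           ≡⟨ cong ((t * (t * t)) *_) (ν-similitude simA) ⟨
    (t * (t * t)) * ν A                   ∎
    where module A = Similitude simA

  δ-I₄ : δ I₄ ≡ 1#
  δ-I₄ = solve 0 (det₃ᴾ (diagᴾ 1ᴾ 1ᴾ 1ᴾ ·ᴾ eᴾ 0F) (diagᴾ 1ᴾ 1ᴾ 1ᴾ ·ᴾ eᴾ 2F) (diagᴾ 1ᴾ 1ᴾ 1ᴾ ·ᴾ eᴾ 3F) := 1ᴾ) refl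

  ν-I₄ : ν I₄ ≡ 1#
  ν-I₄ = trans (ν-similitude I₄-similitude) (*-identityˡ 1#)

  mpow-similitude : ∀ {A} → Similitude A → ∀ n → Similitude (mpow A n)
  mpow-similitude simA zero = I₄-similitude
  mpow-similitude simA (suc n) = similitude-⊗ simA (mpow-similitude simA n)

  δ-mpow : ∀ {A} → Similitude A → ∀ n → δ (mpow A n) ≡ δ A ^ n
  δ-mpow simA zero = δ-I₄
  δ-mpow {A} simA (suc n) = trans (δ-⊗ A (mpow-similitude simA n)) (cong (δ A *_) (δ-mpow simA n))

  ν-mpow : ∀ {A} → Similitude A → ∀ n → ν (mpow A n) ≡ ν A ^ n
  ν-mpow simA zero = ν-I₄
  ν-mpow {A} simA (suc n) = trans (ν-⊗ simA (mpow-similitude simA n)) (cong (ν A *_) (ν-mpow simA n))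

  record InvertibleSimilitude (A : Mat) : Set where
    field
      similitude : Similitude A
      inverse : Mat
      inverse-similitude : Similitude inverse
      scalar : Carrier
      scalar≢0 : scalar ≢ 0#
      inverse-· : ∀ x → inverse · (A · x) ≡ scalar ⊙ x

    inverse-⊗ : Rescaling scalar I₄ (inverse ⊗ A)
    inverse-⊗ x = trans (·-⊗ inverse A x) (trans (inverse-· x) (cong (scalar ⊙_) (sym (I₄-· x))))

  ProjEq⇒Rescaling : ∀ {A B} → (pe : ProjEq B A) → Rescaling (proj₁ pe) A B
  ProjEq⇒Rescaling {A} (t , _ , B≡tA) x = trans (cong (_· x) B≡tA) (•-· t A x)

  t³≢0 : ∀ {t} → t ≢ 0# → t * (t * t) ≢ 0#
  t³≢0 t≢0 = *-≢0 t≢0 (*-≢0 t≢0 t≢0)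

  ν-scalar : ∀ {t A B} → Similitude A → Similitude B → Rescaling t I₄ (A ⊗ B) → ν A * ν B ≡ t * (t * t)
  ν-scalar {t} {A} {B} simA simB AB≡tI = begin
    ν A * ν B                ≡⟨ ν-⊗ simA simB ⟨
    ν (A ⊗ B)                ≡⟨ ν-rescale {A = I₄} {B = A ⊗ B} AB≡tI I₄-similitude ⟩
    (t * (t * t)) * ν I₄     ≡⟨ cong (_ *_) ν-I₄ ⟩
    (t * (t * t)) * 1#       ≡⟨ *-identityʳ _ ⟩
    t * (t * t)              ∎

  δ-scalar : ∀ {t A B} → Similitude B → Rescaling t I₄ (A ⊗ B) → δ A * δ B ≡ t * (t * t)
  δ-scalar {t} {A} {B} simB AB≡tI = begin
    δ A * δ B                ≡⟨ δ-⊗ A simB ⟨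
    δ (A ⊗ B)                ≡⟨ δ-rescale {A = I₄} {B = A ⊗ B} AB≡tI ⟩
    (t * (t * t)) * δ I₄     ≡⟨ cong (_ *_) δ-I₄ ⟩
    (t * (t * t)) * 1#       ≡⟨ *-identityʳ _ ⟩
    t * (t * t)              ∎

  ν≢0 : ∀ {A} → InvertibleSimilitude A → ν A ≢ 0#
  ν≢0 {A} inv νA≡0 = t³≢0 scalar≢0 (begin
    scalar * (scalar * scalar)   ≡⟨ ν-scalar {A = inverse} {B = A} inverse-similitude similitude inverse-⊗ ⟨
    ν inverse * ν A              ≡⟨ cong (ν inverse *_) νA≡0 ⟩
    ν inverse * 0#               ≡⟨ zeroʳ _ ⟩
    0#                           ∎)
    where open InvertibleSimilitude inv

  invertible-⊗ : ∀ {A B} → InvertibleSimilitude A → InvertibleSimilitude B → InvertibleSimilitude (A ⊗ B)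
  invertible-⊗ {A} {B} invA invB = record
    { similitude = similitude-⊗ A.similitude B.similitude
    ; inverse = B.inverse ⊗ A.inverse
    ; inverse-similitude = similitude-⊗ B.inverse-similitude A.inverse-similitude
    ; scalar = A.scalar * B.scalar
    ; scalar≢0 = *-≢0 A.scalar≢0 B.scalar≢0
    ; inverse-· = λ x → begin
        (B.inverse ⊗ A.inverse) · ((A ⊗ B) · x)  ≡⟨ cong₂ _·_ {B.inverse ⊗ A.inverse} refl (·-⊗ A B x) ⟩
        (B.inverse ⊗ A.inverse) · (A · (B · x))  ≡⟨ ·-⊗ B.inverse A.inverse _ ⟩
        B.inverse · (A.inverse · (A · (B · x)))  ≡⟨ cong (B.inverse ·_) (A.inverse-· (B · x)) ⟩
        B.inverse · (A.scalar ⊙ (B · x))         ≡⟨ ·-⊙ B.inverse A.scalar (B · x) ⟩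
        A.scalar ⊙ (B.inverse · (B · x))         ≡⟨ cong (A.scalar ⊙_) (B.inverse-· x) ⟩
        A.scalar ⊙ (B.scalar ⊙ x)                ≡⟨ ⊙-⊙ A.scalar B.scalar x ⟩
        (A.scalar * B.scalar) ⊙ x                ∎
    }
    where
    module A = InvertibleSimilitude invA
    module B = InvertibleSimilitude invB

  invertible-rescale : ∀ {t A B} → t ≢ 0# → Rescaling t A B → InvertibleSimilitude A → InvertibleSimilitude B
  invertible-rescale {t} {A} {B} t≢0 B≡tA invA = record
    { similitude = similitude-rescale B≡tA A.similitude
    ; inverse = A.inverse
    ; inverse-similitude = A.inverse-similitude
    ; scalar = t * A.scalar
    ; scalar≢0 = *-≢0 t≢0 A.scalar≢0
    ; inverse-· = λ x → begin
        A.inverse · (B · x)          ≡⟨ cong (A.inverse ·_) (B≡tA x) ⟩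
        A.inverse · (t ⊙ (A · x))    ≡⟨ ·-⊙ A.inverse t (A · x) ⟩
        t ⊙ (A.inverse · (A · x))    ≡⟨ cong (t ⊙_) (A.inverse-· x) ⟩
        t ⊙ (A.scalar ⊙ x)           ≡⟨ ⊙-⊙ t A.scalar x ⟩
        (t * A.scalar) ⊙ x           ∎
    }
    where module A = InvertibleSimilitude invA

  inverse-rescaling : ∀ {t A B} → (invA : InvertibleSimilitude A) → Rescaling t I₄ (A ⊗ B) →
                      Rescaling (InvertibleSimilitude.scalar invA ⁻¹ * t) (InvertibleSimilitude.inverse invA) B
  inverse-rescaling {t} {A} {B} invA AB≡tI x = begin
    B · x                                     ≡⟨ 1⊙ (B · x) ⟨
    1# ⊙ (B · x)                              ≡⟨ cong (_⊙ (B · x)) (⁻¹-inverseˡ scalar≢0) ⟨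
    (scalar ⁻¹ * scalar) ⊙ (B · x)            ≡⟨ ⊙-⊙ _ _ _ ⟨
    (scalar ⁻¹) ⊙ (scalar ⊙ (B · x))            ≡⟨ cong ((scalar ⁻¹) ⊙_) (inverse-· (B · x)) ⟨
    (scalar ⁻¹) ⊙ (inverse · (A · (B · x)))     ≡⟨ cong (λ y → (scalar ⁻¹) ⊙ (inverse · y)) AB·x≡tx ⟩
    (scalar ⁻¹) ⊙ (inverse · (t ⊙ x))           ≡⟨ cong ((scalar ⁻¹) ⊙_) (·-⊙ inverse t x) ⟩
    (scalar ⁻¹) ⊙ (t ⊙ (inverse · x))           ≡⟨ ⊙-⊙ _ _ _ ⟩
    (scalar ⁻¹ * t) ⊙ (inverse · x)           ∎
    where
    open InvertibleSimilitude invA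
    AB·x≡tx : A · (B · x) ≡ t ⊙ x
    AB·x≡tx = trans (sym (·-⊗ A B x)) (trans (AB≡tI x) (cong (t ⊙_) (I₄-· x)))

  invertible-inverse : ∀ {t A B} → t ≢ 0# → Rescaling t I₄ (A ⊗ B) → InvertibleSimilitude A → InvertibleSimilitude B
  invertible-inverse {t} {A} {B} t≢0 AB≡tI invA = record
    { similitude = similitude-rescale (inverse-rescaling invA AB≡tI) A.inverse-similitude
    ; inverse = A
    ; inverse-similitude = A.similitude
    ; scalar = t
    ; scalar≢0 = t≢0
    ; inverse-· = λ x → trans (sym (·-⊗ A B x)) (trans (AB≡tI x) (cong (t ⊙_) (I₄-· x)))
    }
    where module A = InvertibleSimilitude invA

  -- The character
  -- With χ A = (δ A / ν A) ^ half, these say χ A ² ≡ 1 and χ A ≡ 1, without dividing.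
  χ²≡1 χ≡1 : Mat → Set
  χ²≡1 A = δ A ^ half * δ A ^ half ≡ ν A ^ half * ν A ^ half
  χ≡1 A = δ A ^ half ≡ ν A ^ half

  χ≡1⇒χ²≡1 : ∀ A → χ≡1 A → χ²≡1 A
  χ≡1⇒χ²≡1 A χ≡1 = cong₂ _*_ χ≡1 χ≡1

  χ²≡1-of-δ≡-ν : ∀ A → δ A ≡ - ν A → χ²≡1 A
  χ²≡1-of-δ≡-ν A δ≡-ν = begin
    δ A ^ half * δ A ^ half          ≡⟨ ^-distribʳ-* (δ A) (δ A) half ⟨
    (δ A * δ A) ^ half               ≡⟨ cong (λ d → (d * d) ^ half) δ≡-ν ⟩
    (- ν A * - ν A) ^ half           ≡⟨ cong (_^ half) (-x*-x≡x*x (ν A)) ⟩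
    (ν A * ν A) ^ half               ≡⟨ ^-distribʳ-* (ν A) (ν A) half ⟩
    ν A ^ half * ν A ^ half          ∎

  square-* : ∀ {x₁ x₂ y₁ y₂} → x₁ * x₁ ≡ y₁ * y₁ → x₂ * x₂ ≡ y₂ * y₂ → (x₁ * x₂) * (x₁ * x₂) ≡ (y₁ * y₂) * (y₁ * y₂)
  square-* {x₁} {x₂} {y₁} {y₂} x₁²≡y₁² x₂²≡y₂² = begin
    (x₁ * x₂) * (x₁ * x₂)   ≡⟨ *-interchange x₁ x₂ x₁ x₂ ⟩
    (x₁ * x₁) * (x₂ * x₂)   ≡⟨ cong₂ _*_ x₁²≡y₁² x₂²≡y₂² ⟩
    (y₁ * y₁) * (y₂ * y₂)   ≡⟨ *-interchange y₁ y₁ y₂ y₂ ⟩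
    (y₁ * y₂) * (y₁ * y₂)   ∎

  square-cancel : ∀ {x₁ x₂ y₁ y₂} → y₁ ≢ 0# → x₁ * x₂ ≡ y₁ * y₂ → x₁ * x₁ ≡ y₁ * y₁ → x₂ * x₂ ≡ y₂ * y₂
  square-cancel {x₁} {x₂} {y₁} {y₂} y₁≢0 x₁x₂≡y₁y₂ x₁²≡y₁² = *-cancelˡ (*-≢0 y₁≢0 y₁≢0) (begin
    (y₁ * y₁) * (x₂ * x₂)     ≡⟨ cong (_* (x₂ * x₂)) x₁²≡y₁² ⟨
    (x₁ * x₁) * (x₂ * x₂)     ≡⟨ *-interchange x₁ x₁ x₂ x₂ ⟩
    (x₁ * x₂) * (x₁ * x₂)     ≡⟨ cong₂ _*_ x₁x₂≡y₁y₂ x₁x₂≡y₁y₂ ⟩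
    (y₁ * y₂) * (y₁ * y₂)     ≡⟨ *-interchange y₁ y₂ y₁ y₂ ⟩
    (y₁ * y₁) * (y₂ * y₂)     ∎)

  half-⊗ : ∀ {A B} → Similitude A → Similitude B →
           δ (A ⊗ B) ^ half ≡ δ A ^ half * δ B ^ half × ν (A ⊗ B) ^ half ≡ ν A ^ half * ν B ^ half
  half-⊗ {A} simA simB = trans (cong (_^ half) (δ-⊗ A simB)) (^-distribʳ-* _ _ half)
                       , trans (cong (_^ half) (ν-⊗ simA simB)) (^-distribʳ-* _ _ half)

  half-rescale : ∀ {t A B} → Rescaling t A B → Similitude A →
                 δ B ^ half ≡ (t * (t * t)) ^ half * δ A ^ half × ν B ^ half ≡ (t * (t * t)) ^ half * ν A ^ half
  half-rescale {A = A} {B} B≡tA simA = trans (cong (_^ half) (δ-rescale {A = A} {B} B≡tA)) (^-distribʳ-* _ _ half)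
                                      , trans (cong (_^ half) (ν-rescale {A = A} {B} B≡tA simA)) (^-distribʳ-* _ _ half)

  half-scalar : ∀ {t A B} → Similitude A → Similitude B → Rescaling t I₄ (A ⊗ B) →
                δ A ^ half * δ B ^ half ≡ ν A ^ half * ν B ^ half
  half-scalar {A = A} {B} simA simB AB≡tI = begin
    δ A ^ half * δ B ^ half   ≡⟨ ^-distribʳ-* _ _ half ⟨
    (δ A * δ B) ^ half        ≡⟨ cong (_^ half) (trans (δ-scalar {A = A} simB AB≡tI) (sym (ν-scalar simA simB AB≡tI))) ⟩
    (ν A * ν B) ^ half        ≡⟨ ^-distribʳ-* _ _ half ⟩
    ν A ^ half * ν B ^ half   ∎

  χ²≡1-⊗ : ∀ {A B} → Similitude A → Similitude B → χ²≡1 A → χ²≡1 B → χ²≡1 (A ⊗ B)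
  χ²≡1-⊗ simA simB χA χB with half-⊗ simA simB
  ... | δ≡ , ν≡ = subst₂ (λ x y → x * x ≡ y * y) (sym δ≡) (sym ν≡) (square-* χA χB)

  χ≡1-⊗ : ∀ {A B} → Similitude A → Similitude B → χ≡1 A → χ≡1 B → χ≡1 (A ⊗ B)
  χ≡1-⊗ simA simB χA χB with half-⊗ simA simB
  ... | δ≡ , ν≡ = trans δ≡ (trans (cong₂ _*_ χA χB) (sym ν≡))

  χ²≡1-rescale : ∀ {t A B} → Rescaling t A B → Similitude A → χ²≡1 A → χ²≡1 B
  χ²≡1-rescale B≡tA simA χA with half-rescale B≡tA simA
  ... | δ≡ , ν≡ = subst₂ (λ x y → x * x ≡ y * y) (sym δ≡) (sym ν≡) (square-* refl χA)

  χ≡1-rescale : ∀ {t A B} → Rescaling t A B → Similitude A → χ≡1 A → χ≡1 B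
  χ≡1-rescale B≡tA simA χA with half-rescale B≡tA simA
  ... | δ≡ , ν≡ = trans δ≡ (trans (cong (_ *_) χA) (sym ν≡))

  χ²≡1-inverse : ∀ {t A B} → InvertibleSimilitude A → Similitude B → Rescaling t I₄ (A ⊗ B) → χ²≡1 A → χ²≡1 B
  χ²≡1-inverse invA simB AB≡tI χA =
    square-cancel (^-≢0 half (ν≢0 invA)) (half-scalar (InvertibleSimilitude.similitude invA) simB AB≡tI) χA

  χ≡1-inverse : ∀ {t A B} → InvertibleSimilitude A → Similitude B → Rescaling t I₄ (A ⊗ B) → χ≡1 A → χ≡1 B
  χ≡1-inverse {A = A} {B} invA simB AB≡tI χA = *-cancelˡ (^-≢0 half (ν≢0 invA)) (begin
    ν A ^ half * δ B ^ half   ≡⟨ cong (_* δ B ^ half) χA ⟨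
    δ A ^ half * δ B ^ half   ≡⟨ half-scalar (InvertibleSimilitude.similitude invA) simB AB≡tI ⟩
    ν A ^ half * ν B ^ half   ∎)

  -- χ (A ^ n) = 1 as A ^ n is a scalar matrix, and χ A ² = 1 with n odd then forces χ A = 1.
  χ≡1-of-odd-order : ∀ {A n} → Odd n → InvertibleSimilitude A → χ²≡1 A → ProjEq (mpow A n) I₄ → χ≡1 A
  χ≡1-of-odd-order {A} {n} n-odd invA χA pe@(t , _ , _) = ^-odd-injective n-odd (begin
    (δ A ^ half) ^ n          ≡⟨ ^-comm (δ A) half n ⟩
    (δ A ^ n) ^ half          ≡⟨ cong (_^ half) (trans (sym (δ-mpow simA n)) (δ-rescale {A = I₄} {mpow A n} Aⁿ≡tI)) ⟩
    ((t * (t * t)) * δ I₄) ^ half ≡⟨ cong (λ d → ((t * (t * t)) * d) ^ half) (trans δ-I₄ (sym ν-I₄)) ⟩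
    ((t * (t * t)) * ν I₄) ^ half ≡⟨ cong (_^ half) (trans (sym (ν-rescale {A = I₄} {mpow A n} Aⁿ≡tI I₄-similitude)) (ν-mpow simA n)) ⟩
    (ν A ^ n) ^ half          ≡⟨ ^-comm (ν A) half n ⟨
    (ν A ^ half) ^ n          ∎) χA (^-≢0 half (ν≢0 invA))
    where
    simA : Similitude A
    simA = InvertibleSimilitude.similitude invA
    Aⁿ≡tI : Rescaling t I₄ (mpow A n)
    Aⁿ≡tI = ProjEq⇒Rescaling pe

  diag-1 : ∀ {a b d} → a ≡ 1# → b ≡ 1# → d ≡ 1# → ∀ x → diag a b d · x ≡ 1# ⊙ x
  diag-1 refl refl refl x = trans (I₄-· x) (sym (1⊙ x))

  T-inverse : ∀ α x → T (- α) · (T α · x) ≡ diag 1# 1# 1# · x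
  T-inverse α (x₀ ∷ x₁ ∷ x₂ ∷ x₃ ∷ []) = ≡-by-dot λ where
    (y₀ ∷ y₁ ∷ y₂ ∷ y₃ ∷ []) → solve 9 (λ α x₀ x₁ x₂ x₃ y₀ y₁ y₂ y₃ →
      let x = x₀ ∷ x₁ ∷ x₂ ∷ x₃ ∷ [] ; y = y₀ ∷ y₁ ∷ y₂ ∷ y₃ ∷ []
      in dotᴾ y (Tᴾ (:- α) ·ᴾ (Tᴾ α ·ᴾ x)) := dotᴾ y (diagᴾ 1ᴾ 1ᴾ 1ᴾ ·ᴾ x)) refl α x₀ x₁ x₂ x₃ y₀ y₁ y₂ y₃

  diag-inverse : ∀ a b d a′ b′ d′ x → diag a′ b′ d′ · (diag a b d · x) ≡ diag (a′ * a) (b′ * b) (d′ * d) · x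
  diag-inverse a b d a′ b′ d′ (x₀ ∷ x₁ ∷ x₂ ∷ x₃ ∷ []) = ≡-by-dot λ where
    (y₀ ∷ y₁ ∷ y₂ ∷ y₃ ∷ []) → solve 14 (λ a b d a′ b′ d′ x₀ x₁ x₂ x₃ y₀ y₁ y₂ y₃ →
      let x = x₀ ∷ x₁ ∷ x₂ ∷ x₃ ∷ [] ; y = y₀ ∷ y₁ ∷ y₂ ∷ y₃ ∷ []
      in dotᴾ y (diagᴾ a′ b′ d′ ·ᴾ (diagᴾ a b d ·ᴾ x)) := dotᴾ y (diagᴾ (a′ :* a) (b′ :* b) (d′ :* d) ·ᴾ x))
      refl a b d a′ b′ d′ x₀ x₁ x₂ x₃ y₀ y₁ y₂ y₃

  N-inverse : ∀ σ σ′ x → N σ′ · (N σ · x) ≡ diag 1# (σ′ * σ) 1# · x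
  N-inverse σ σ′ (x₀ ∷ x₁ ∷ x₂ ∷ x₃ ∷ []) = ≡-by-dot λ where
    (y₀ ∷ y₁ ∷ y₂ ∷ y₃ ∷ []) → solve 10 (λ σ σ′ x₀ x₁ x₂ x₃ y₀ y₁ y₂ y₃ →
      let x = x₀ ∷ x₁ ∷ x₂ ∷ x₃ ∷ [] ; y = y₀ ∷ y₁ ∷ y₂ ∷ y₃ ∷ []
      in dotᴾ y (Nᴾ σ′ ·ᴾ (Nᴾ σ ·ᴾ x)) := dotᴾ y (diagᴾ 1ᴾ (σ′ :* σ) 1ᴾ ·ᴾ x)) refl σ σ′ x₀ x₁ x₂ x₃ y₀ y₁ y₂ y₃

  R-inverse : ∀ μ x → R μ · (R μ · x) ≡ diag (μ ⁻¹ * μ) 1# (μ * μ ⁻¹) · x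
  R-inverse μ (x₀ ∷ x₁ ∷ x₂ ∷ x₃ ∷ []) = ≡-by-dot λ where
    (y₀ ∷ y₁ ∷ y₂ ∷ y₃ ∷ []) → solve 10 (λ μ⁻¹ μ x₀ x₁ x₂ x₃ y₀ y₁ y₂ y₃ →
      let x = x₀ ∷ x₁ ∷ x₂ ∷ x₃ ∷ [] ; y = y₀ ∷ y₁ ∷ y₂ ∷ y₃ ∷ []
      in dotᴾ y (Rᴾ μ⁻¹ μ ·ᴾ (Rᴾ μ⁻¹ μ ·ᴾ x)) := dotᴾ y (diagᴾ (μ⁻¹ :* μ) 1ᴾ (μ :* μ⁻¹) ·ᴾ x))
      refl (μ ⁻¹) μ x₀ x₁ x₂ x₃ y₀ y₁ y₂ y₃

  Q-T : ∀ α x → Q (T α · x) ≡ 1# * Q x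
  Q-T α (x₀ ∷ x₁ ∷ x₂ ∷ x₃ ∷ []) = solve 5 (λ α x₀ x₁ x₂ x₃ →
    Qᴾ (Tᴾ α ·ᴾ (x₀ ∷ x₁ ∷ x₂ ∷ x₃ ∷ [])) := 1ᴾ :* Qᴾ (x₀ ∷ x₁ ∷ x₂ ∷ x₃ ∷ [])) refl α x₀ x₁ x₂ x₃

  Q-N : ∀ σ x → Q (N σ · x) ≡ 1# * Q x
  Q-N σ (x₀ ∷ x₁ ∷ x₂ ∷ x₃ ∷ []) = solve 5 (λ σ x₀ x₁ x₂ x₃ →
    Qᴾ (Nᴾ σ ·ᴾ (x₀ ∷ x₁ ∷ x₂ ∷ x₃ ∷ [])) := 1ᴾ :* Qᴾ (x₀ ∷ x₁ ∷ x₂ ∷ x₃ ∷ [])) refl σ x₀ x₁ x₂ x₃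

  -- Q (diag a b d · x) and Q (R μ · x) take this form, with r = a * d, resp. r = μ ⁻¹ * μ.
  Q-rescaled : ∀ {r} → r ≡ 1# → ∀ x₀ x₁ x₂ x₃ → x₂ * x₂ + - (r * (x₀ * x₃)) ≡ 1# * Q (x₀ ∷ x₁ ∷ x₂ ∷ x₃ ∷ [])
  Q-rescaled refl x₀ x₁ x₂ x₃ = solve 4 (λ x₀ x₁ x₂ x₃ →
    x₂ :* x₂ :+ :- (1ᴾ :* (x₀ :* x₃)) := 1ᴾ :* Qᴾ (x₀ ∷ x₁ ∷ x₂ ∷ x₃ ∷ [])) refl x₀ x₁ x₂ x₃

  Q-diag : ∀ {a d} b → a * d ≡ 1# → ∀ x → Q (diag a b d · x) ≡ 1# * Q x
  Q-diag {a} {d} b ad≡1 (x₀ ∷ x₁ ∷ x₂ ∷ x₃ ∷ []) = trans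
    (solve 7 (λ a b d x₀ x₁ x₂ x₃ → Qᴾ (diagᴾ a b d ·ᴾ (x₀ ∷ x₁ ∷ x₂ ∷ x₃ ∷ [])) := x₂ :* x₂ :+ :- ((a :* d) :* (x₀ :* x₃)))
      refl a b d x₀ x₁ x₂ x₃)
    (Q-rescaled ad≡1 x₀ x₁ x₂ x₃)

  Q-R : ∀ {μ} → μ ⁻¹ * μ ≡ 1# → ∀ x → Q (R μ · x) ≡ 1# * Q x
  Q-R {μ} μ⁻¹μ≡1 (x₀ ∷ x₁ ∷ x₂ ∷ x₃ ∷ []) = trans
    (solve 6 (λ μ⁻¹ μ x₀ x₁ x₂ x₃ → Qᴾ (Rᴾ μ⁻¹ μ ·ᴾ (x₀ ∷ x₁ ∷ x₂ ∷ x₃ ∷ [])) := x₂ :* x₂ :+ :- ((μ⁻¹ :* μ) :* (x₀ :* x₃)))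
      refl (μ ⁻¹) μ x₀ x₁ x₂ x₃)
    (Q-rescaled μ⁻¹μ≡1 x₀ x₁ x₂ x₃)

  δ-T : ∀ α → δ (T α) ≡ 1#
  δ-T α = solve 1 (λ α → det₃ᴾ (Tᴾ α ·ᴾ eᴾ 0F) (Tᴾ α ·ᴾ eᴾ 2F) (Tᴾ α ·ᴾ eᴾ 3F) := 1ᴾ) refl α

  δ-diag : ∀ a b d → δ (diag a b d) ≡ a * d
  δ-diag = solve 3 (λ a b d → det₃ᴾ (diagᴾ a b d ·ᴾ eᴾ 0F) (diagᴾ a b d ·ᴾ eᴾ 2F) (diagᴾ a b d ·ᴾ eᴾ 3F) := a :* d) refl

  δ-N : ∀ σ → δ (N σ) ≡ - 1#
  δ-N = solve 1 (λ σ → det₃ᴾ (Nᴾ σ ·ᴾ eᴾ 0F) (Nᴾ σ ·ᴾ eᴾ 2F) (Nᴾ σ ·ᴾ eᴾ 3F) := :- 1ᴾ) refl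

  δ-R : ∀ μ → δ (R μ) ≡ - (μ ⁻¹ * μ)
  δ-R μ = solve 2 (λ μ⁻¹ μ → det₃ᴾ (Rᴾ μ⁻¹ μ ·ᴾ eᴾ 0F) (Rᴾ μ⁻¹ μ ·ᴾ eᴾ 2F) (Rᴾ μ⁻¹ μ ·ᴾ eᴾ 3F) := :- (μ⁻¹ :* μ)) refl (μ ⁻¹) μ

  T-similitude : ∀ α → Similitude (T α)
  T-similitude α = block-similitude refl refl (Q-T α)

  diag-similitude : ∀ {a d} b → a * d ≡ 1# → Similitude (diag a b d)
  diag-similitude b ad≡1 = block-similitude refl refl (Q-diag b ad≡1)

  N-similitude : ∀ σ → Similitude (N σ)
  N-similitude σ = block-similitude refl refl (Q-N σ)

  R-similitude : ∀ {μ} → μ ⁻¹ * μ ≡ 1# → Similitude (R μ)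
  R-similitude μ⁻¹μ≡1 = block-similitude refl refl (Q-R μ⁻¹μ≡1)

  T-invertible : ∀ α → InvertibleSimilitude (T α)
  T-invertible α = record
    { similitude = T-similitude α ; inverse = T (- α) ; inverse-similitude = T-similitude (- α)
    ; scalar = 1# ; scalar≢0 = 1≢0 ; inverse-· = λ x → trans (T-inverse α x) (diag-1 refl refl refl x) }

  diag-invertible : ∀ {a b d a′ b′ d′} → a * d ≡ 1# → a′ * d′ ≡ 1# →
                    a′ * a ≡ 1# → b′ * b ≡ 1# → d′ * d ≡ 1# → InvertibleSimilitude (diag a b d)
  diag-invertible {a} {b} {d} {a′} {b′} {d′} ad≡1 a′d′≡1 a′a≡1 b′b≡1 d′d≡1 = record
    { similitude = diag-similitude b ad≡1 ; inverse = diag a′ b′ d′ ; inverse-similitude = diag-similitude b′ a′d′≡1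
    ; scalar = 1# ; scalar≢0 = 1≢0
    ; inverse-· = λ x → trans (diag-inverse a b d a′ b′ d′ x) (diag-1 a′a≡1 b′b≡1 d′d≡1 x) }

  N-invertible : ∀ {σ} → σ ≢ 0# → InvertibleSimilitude (N σ)
  N-invertible {σ} σ≢0 = record
    { similitude = N-similitude σ ; inverse = N (σ ⁻¹) ; inverse-similitude = N-similitude (σ ⁻¹)
    ; scalar = 1# ; scalar≢0 = 1≢0
    ; inverse-· = λ x → trans (N-inverse σ (σ ⁻¹) x) (diag-1 refl (⁻¹-inverseˡ σ≢0) refl x) }

  R-invertible : ∀ {μ} → μ ≢ 0# → InvertibleSimilitude (R μ)
  R-invertible {μ} μ≢0 = record
    { similitude = R-similitude (⁻¹-inverseˡ μ≢0) ; inverse = R μ ; inverse-similitude = R-similitude (⁻¹-inverseˡ μ≢0)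
    ; scalar = 1# ; scalar≢0 = 1≢0
    ; inverse-· = λ x → trans (R-inverse μ x) (diag-1 (⁻¹-inverseˡ μ≢0) refl (inverseʳ μ μ≢0) x) }

  χ≡1-of : ∀ A {d n} → δ A ≡ d → ν A ≡ n → d ^ half ≡ n ^ half → χ≡1 A
  χ≡1-of A δ≡d ν≡n dʰ≡nʰ = trans (cong (_^ half) δ≡d) (trans dʰ≡nʰ (cong (_^ half) (sym ν≡n)))

  χ≡1-T : ∀ α → χ≡1 (T α)
  χ≡1-T α = χ≡1-of (T α) (δ-T α) (trans (ν-similitude (T-similitude α)) (*-identityˡ 1#)) refl

  χ≡1-M : ∀ {ρ} → ρ ≢ 0# → χ≡1 (M ρ)
  χ≡1-M {ρ} ρ≢0 = χ≡1-of (M ρ) (trans (δ-diag (ρ ⁻¹) 1# ρ) (⁻¹-inverseˡ ρ≢0))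
    (trans (ν-similitude (diag-similitude 1# (⁻¹-inverseˡ ρ≢0))) (*-identityˡ 1#)) refl

  χ≡1-L : ∀ {λ′} → λ′ ^ half ≡ 1# → χ≡1 (L λ′)
  χ≡1-L {λ′} λʰ≡1 = χ≡1-of (L λ′) (trans (δ-diag 1# λ′ 1#) (*-identityˡ 1#))
    (trans (ν-similitude (diag-similitude λ′ (*-identityˡ 1#))) (*-identityʳ λ′)) (trans (1^n≡1 half) (sym λʰ≡1))

  χ≡1-N : ∀ {σ} → Odd half → σ ^ half ≡ - 1# → χ≡1 (N σ)
  χ≡1-N {σ} half-odd σʰ≡-1 = χ≡1-of (N σ) (δ-N σ) (trans (ν-similitude (N-similitude σ)) (*-identityʳ σ))
    (trans (-‿^-odd 1# half-odd) (trans (cong -_ (1^n≡1 half)) (sym σʰ≡-1)))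

  χ²≡1-R : ∀ {μ} → μ ≢ 0# → χ²≡1 (R μ)
  χ²≡1-R {μ} μ≢0 = χ²≡1-of-δ≡-ν (R μ) (begin
    δ (R μ)             ≡⟨ δ-R μ ⟩
    - (μ ⁻¹ * μ)        ≡⟨ cong -_ (⁻¹-inverseˡ μ≢0) ⟩
    - 1#                ≡⟨ cong -_ (trans (ν-similitude (R-similitude (⁻¹-inverseˡ μ≢0))) (*-identityˡ 1#)) ⟨
    - ν (R μ)           ∎)

  x^half≡1⇒x≢0 : ∀ {λ′} → Odd half → λ′ ^ half ≡ 1# → λ′ ≢ 0#
  x^half≡1⇒x≢0 half-odd λʰ≡1 refl = 0≢1 (trans (sym (0^odd half-odd)) λʰ≡1)

  x^half≡-1⇒x≢0 : ∀ {σ} → Odd half → σ ^ half ≡ - 1# → σ ≢ 0#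
  x^half≡-1⇒x≢0 half-odd σʰ≡-1 refl =
    1≢0 (trans (sym (-‿involutive 1#)) (trans (cong -_ (trans (sym σʰ≡-1) (0^odd half-odd))) -0#≈0#))

  NonSquareFq⇒≢0 : ∀ {μ} → Odd q → NonSquareFq μ → μ ≢ 0#
  NonSquareFq⇒≢0 q-odd (_ , not-square) refl = not-square (0# , 0^odd q-odd , zeroˡ 0#)

  InG⇒χ²≡1 : Odd q → Odd half → ∀ {A} → InG A → InvertibleSimilitude A × χ²≡1 A
  InG⇒χ²≡1 q-odd half-odd = go
    where
    go : ∀ {A} → InG A → InvertibleSimilitude A × χ²≡1 A
    go (gT {α} _) = T-invertible α , χ≡1⇒χ²≡1 (T α) (χ≡1-T α)
    go (gM {ρ} (_ , ρ≢0 , _)) =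
      diag-invertible (⁻¹-inverseˡ ρ≢0) (inverseʳ ρ ρ≢0) (inverseʳ ρ ρ≢0) (*-identityˡ 1#) (⁻¹-inverseˡ ρ≢0)
      , χ≡1⇒χ²≡1 (M ρ) (χ≡1-M ρ≢0)
    go (gL {λ′} λʰ≡1) =
      diag-invertible (*-identityˡ 1#) (*-identityˡ 1#) (*-identityˡ 1#) (⁻¹-inverseˡ (x^half≡1⇒x≢0 half-odd λʰ≡1)) (*-identityˡ 1#)
      , χ≡1⇒χ²≡1 (L λ′) (χ≡1-L λʰ≡1)
    go (gN {σ} σʰ≡-1) = N-invertible (x^half≡-1⇒x≢0 half-odd σʰ≡-1) , χ≡1⇒χ²≡1 (N σ) (χ≡1-N half-odd σʰ≡-1)
    go (gR μ-nonSquare) = R-invertible (NonSquareFq⇒≢0 q-odd μ-nonSquare) , χ²≡1-R (NonSquareFq⇒≢0 q-odd μ-nonSquare)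
    go (gMul a b) with go a | go b
    ... | invA , χA | invB , χB = invertible-⊗ invA invB , χ²≡1-⊗ (similitude invA) (similitude invB) χA χB
      where open InvertibleSimilitude
    go (gInv {B = B} a pe@(_ , t≢0 , _)) with go a
    ... | invA , χA = invB , χ²≡1-inverse invA (InvertibleSimilitude.similitude invB) (ProjEq⇒Rescaling pe) χA
      where
      invB : InvertibleSimilitude B
      invB = invertible-inverse t≢0 (ProjEq⇒Rescaling pe) invA
    go (gProj a pe@(_ , t≢0 , _)) with go a
    ... | invA , χA = invertible-rescale t≢0 (ProjEq⇒Rescaling pe) invA
                    , χ²≡1-rescale (ProjEq⇒Rescaling pe) (InvertibleSimilitude.similitude invA) χA

  InH⇒χ≡1 : Odd q → Odd half → ∀ {p} → Odd p → ∀ {A} → InH p A → InvertibleSimilitude A × χ≡1 A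
  InH⇒χ≡1 q-odd half-odd {p} p-odd = go
    where
    go : ∀ {A} → InH p A → InvertibleSimilitude A × χ≡1 A
    go (hP g (m , pe)) with InG⇒χ²≡1 q-odd half-odd g
    ... | invA , χ²A = invA , χ≡1-of-odd-order (odd-^ p-odd m) invA χ²A pe
    go (hL {λ′} λʰ≡1) =
      diag-invertible (*-identityˡ 1#) (*-identityˡ 1#) (*-identityˡ 1#) (⁻¹-inverseˡ (x^half≡1⇒x≢0 half-odd λʰ≡1)) (*-identityˡ 1#)
      , χ≡1-L λʰ≡1
    go (hMul a b) with go a | go b
    ... | invA , χA | invB , χB = invertible-⊗ invA invB , χ≡1-⊗ (similitude invA) (similitude invB) χA χB
      where open InvertibleSimilitude
    go (hInv {B = B} a pe@(_ , t≢0 , _)) with go a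
    ... | invA , χA = invB , χ≡1-inverse invA (InvertibleSimilitude.similitude invB) (ProjEq⇒Rescaling pe) χA
      where
      invB : InvertibleSimilitude B
      invB = invertible-inverse t≢0 (ProjEq⇒Rescaling pe) invA
    go (hProj a pe@(_ , t≢0 , _)) with go a
    ... | invA , χA = invertible-rescale t≢0 (ProjEq⇒Rescaling pe) invA
                    , χ≡1-rescale (ProjEq⇒Rescaling pe) (InvertibleSimilitude.similitude invA) χA

  P : Carrier → Carrier → V4
  P t b = 1# ∷ t * b ∷ b ∷ 0# ∷ []

  span-O-P : ∀ α β t b → (α ⊙ e 0F) ⊕ (β ⊙ P t b) ≡ (α + β ∷ β * (t * b) ∷ β * b ∷ 0# ∷ [])
  span-O-P α β t b = ≡-V4
    (solve 2 (λ α β → α :* 1ᴾ :+ β :* 1ᴾ := α :+ β) refl α β)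
    (solve 4 (λ α β t b → α :* 0ᴾ :+ β :* (t :* b) := β :* (t :* b)) refl α β t b)
    (solve 3 (λ α β b → α :* 0ᴾ :+ β :* b := β :* b) refl α β b)
    (solve 2 (λ α β → α :* 0ᴾ :+ β :* 0ᴾ := 0ᴾ) refl α β)

  generator-line : Odd q → ∀ {t} b → t ^ (q ℕ.+ 1) ≡ - 2# → IsGenerator (e 0F) (P t b)
  generator-line q-odd {t} b tᵠ⁺¹≡-2 x (α , β , x≡) = subst OnU3 (sym (trans x≡ (span-O-P α β t b))) (begin
    (β * (t * b)) ^ (q ℕ.+ 1) + 2# * (β * b) ^ (q ℕ.+ 1)
      ≡⟨ cong (λ z → z ^ (q ℕ.+ 1) + 2# * (β * b) ^ (q ℕ.+ 1)) (solve 3 (λ β t b → β :* (t :* b) := t :* (β :* b)) refl β t b) ⟩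
    (t * (β * b)) ^ (q ℕ.+ 1) + 2# * (β * b) ^ (q ℕ.+ 1)
      ≡⟨ cong (_+ 2# * (β * b) ^ (q ℕ.+ 1)) (trans (^-distribʳ-* t (β * b) (q ℕ.+ 1)) (cong (_* (β * b) ^ (q ℕ.+ 1)) tᵠ⁺¹≡-2)) ⟩
    - 2# * (β * b) ^ (q ℕ.+ 1) + 2# * (β * b) ^ (q ℕ.+ 1)
      ≡⟨ solve 1 (λ y → :- 2ᴾ :* y :+ 2ᴾ :* y := 0ᴾ) refl _ ⟩
    0#
      ≡⟨ solve 2 (λ z w → 0ᴾ :* z :+ 0ᴾ :* w := 0ᴾ) refl (α + β) ((α + β) ^ q) ⟨
    0# * (α + β) + 0# * (α + β) ^ q
      ≡⟨ cong (λ z → z * (α + β) + 0# * (α + β) ^ q) (0^odd q-odd) ⟨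
    0# ^ q * (α + β) + 0# * (α + β) ^ q ∎)

  δ-columns : ∀ A → δ A ≡ det₃ (column A 0F) (column A 2F) (column A 3F)
  δ-columns A = cong₃ det₃ (·-e A 0F) (·-e A 2F) (·-e A 3F)

  -- The last two hypotheses are Q-∘ at e₃ and at e₀ + e₃; together they give a₀₀ a₃₃ = k.
  δ-triangular : ∀ {a₀₀ a₀₂ a₀₃ a₂₀ a₂₂ a₂₃ a₃₀ a₃₂ a₃₃ c k} x y z → a₂₀ ≡ 0# → a₃₀ ≡ 0# → a₃₂ ≡ 0# → a₂₂ ≡ - c →
                 a₂₃ * a₂₃ + - (a₀₃ * a₃₃) ≡ 0# → (a₂₀ + a₂₃) * (a₂₀ + a₂₃) + - ((a₀₀ + a₀₃) * (a₃₀ + a₃₃)) ≡ - k →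
                 det₃ (a₀₀ ∷ x ∷ a₂₀ ∷ a₃₀ ∷ []) (a₀₂ ∷ y ∷ a₂₂ ∷ a₃₂ ∷ []) (a₀₃ ∷ z ∷ a₂₃ ∷ a₃₃ ∷ []) ≡ - (c * k)
  δ-triangular {a₀₀} {a₀₂} {a₀₃} {a₂₃ = a₂₃} {a₃₃ = a₃₃} {c = c} {k} x y z refl refl refl refl Q-e₃ Q-e₀₃ = begin
    _                       ≡⟨ solve 6 (λ a₀₀ a₀₂ a₀₃ a₂₃ a₃₃ c →
                                 det₃ᴾ (a₀₀ ∷ 0ᴾ ∷ 0ᴾ ∷ 0ᴾ ∷ []) (a₀₂ ∷ 0ᴾ ∷ :- c ∷ 0ᴾ ∷ []) (a₀₃ ∷ 0ᴾ ∷ a₂₃ ∷ a₃₃ ∷ [])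
                                 := :- (c :* (a₀₀ :* a₃₃))) refl a₀₀ a₀₂ a₀₃ a₂₃ a₃₃ c ⟩
    - (c * (a₀₀ * a₃₃))     ≡⟨ cong (λ z → - (c * z)) a₀₀a₃₃≡k ⟩
    - (c * k)               ∎
    where
    a₀₀a₃₃≡k : a₀₀ * a₃₃ ≡ k
    a₀₀a₃₃≡k = trans (sym (-‿involutive _)) (trans (cong -_ (begin
      - (a₀₀ * a₃₃)                                                     ≡⟨ +-identityˡ _ ⟨
      0# + - (a₀₀ * a₃₃)                                                ≡⟨ cong (_+ - (a₀₀ * a₃₃)) Q-e₃ ⟨
      (a₂₃ * a₂₃ + - (a₀₃ * a₃₃)) + - (a₀₀ * a₃₃)
        ≡⟨ solve 4 (λ a₀₀ a₀₃ a₂₃ a₃₃ → (a₂₃ :* a₂₃ :+ :- (a₀₃ :* a₃₃)) :+ :- (a₀₀ :* a₃₃)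
                     := (0ᴾ :+ a₂₃) :* (0ᴾ :+ a₂₃) :+ :- ((a₀₀ :+ a₀₃) :* (0ᴾ :+ a₃₃))) refl a₀₀ a₀₃ a₂₃ a₃₃ ⟩
      (0# + a₂₃) * (0# + a₂₃) + - ((a₀₀ + a₀₃) * (0# + a₃₃))           ≡⟨ Q-e₀₃ ⟩
      - k                                                               ∎)) (-‿involutive k))

  -- The image of O forces a₂₀ = a₃₀ = 0, and the image of P s b forces a₂₂ = - c and a₃₂ = 0.
  δ≡-ν-of-images : ∀ {s b} → s ≢ 0# → b ≢ 0# → ∀ A → Similitude A →
         OnLine (e 0F) (P (- s) b) (A · e 0F) → OnLine (e 0F) (P (- s) b) (A · P s b) → δ A ≡ - ν A
  δ≡-ν-of-images {s} {b} s≢0 b≢0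
       A@((a₀₀ ∷ a₀₁ ∷ a₀₂ ∷ a₀₃ ∷ []) ∷ (a₁₀ ∷ a₁₁ ∷ a₁₂ ∷ a₁₃ ∷ []) ∷
           (a₂₀ ∷ a₂₁ ∷ a₂₂ ∷ a₂₃ ∷ []) ∷ (a₃₀ ∷ a₃₁ ∷ a₃₂ ∷ a₃₃ ∷ []) ∷ []) sim (α , β , AO≡) (α′ , β′ , AP≡) = begin
    δ A                                                   ≡⟨ δ-columns A ⟩
    det₃ (column A 0F) (column A 2F) (column A 3F)        ≡⟨ δ-triangular a₁₀ a₁₂ a₁₃ a₂₀≡0 a₃₀≡0 a₃₂≡0 a₂₂≡-c Q-e₃ Q-e₀₃ ⟩
    - (c * k)                                             ≡⟨ cong -_ (ν-similitude sim) ⟨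
    - ν A                                                 ∎
    where
    open Similitude sim
    at : ∀ {x y : V4} i → x ≡ y → lookup x i ≡ lookup y i
    at i = cong (λ v → lookup v i)
    column₀≡ : column A 0F ≡ (α + β ∷ β * ((- s) * b) ∷ β * b ∷ 0# ∷ [])
    column₀≡ = trans (sym (·-e A 0F)) (trans AO≡ (span-O-P α β (- s) b))
    AP≡′ : A · P s b ≡ (α′ + β′ ∷ β′ * ((- s) * b) ∷ β′ * b ∷ 0# ∷ [])
    AP≡′ = trans AP≡ (span-O-P α′ β′ (- s) b)
    column₁≡ : column A 1F ≡ c ⊙ e 1F
    column₁≡ = trans (sym (·-e A 1F)) column₁
    -sb≢0 : (- s) * b ≢ 0#
    -sb≢0 = *-≢0 (-‿≢0 s≢0) b≢0
    β≡0 : β ≡ 0#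
    β≡0 = *-cancelʳ -sb≢0 (begin
      β * ((- s) * b)        ≡⟨ at 1F column₀≡ ⟨
      a₁₀                    ≡⟨ at 1F (·-e A 0F) ⟨
      lookup (A · e 0F) 1F   ≡⟨ row₁ (e 0F) ⟩
      c * 0#                 ≡⟨ zeroʳ c ⟩
      0#                     ≡⟨ zeroˡ _ ⟨
      0# * ((- s) * b)       ∎)
    a₂₀≡0 : a₂₀ ≡ 0#
    a₂₀≡0 = trans (at 2F column₀≡) (trans (cong (_* b) β≡0) (zeroˡ b))
    a₃₀≡0 : a₃₀ ≡ 0#
    a₃₀≡0 = at 3F column₀≡
    β′≡-c : β′ ≡ - c
    β′≡-c = *-cancelʳ (*-≢0 s≢0 b≢0) (begin
      β′ * (s * b)           ≡⟨ solve 3 (λ β s b → β :* (s :* b) := :- (β :* ((:- s) :* b))) refl β′ s b ⟩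
      - (β′ * ((- s) * b))   ≡⟨ cong -_ (at 1F AP≡′) ⟨
      - lookup (A · P s b) 1F ≡⟨ cong -_ (row₁ (P s b)) ⟩
      - (c * (s * b))        ≡⟨ -‿distribˡ-* c _ ⟩
      - c * (s * b)          ∎)
    through-P : ∀ r₀ r₁ r₂ r₃ {w} → r₀ ≡ 0# → r₁ ≡ 0# → dot (r₀ ∷ r₁ ∷ r₂ ∷ r₃ ∷ []) (P s b) ≡ w → r₂ * b ≡ w
    through-P r₀ r₁ r₂ r₃ refl refl r·P≡w = trans
      (solve 4 (λ r₂ r₃ s b → r₂ :* b := dotᴾ (0ᴾ ∷ 0ᴾ ∷ r₂ ∷ r₃ ∷ []) (1ᴾ ∷ s :* b ∷ b ∷ 0ᴾ ∷ [])) refl r₂ r₃ s b) r·P≡w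
    a₂₂≡-c : a₂₂ ≡ - c
    a₂₂≡-c = trans (*-cancelʳ b≢0 (through-P a₂₀ a₂₁ a₂₂ a₂₃ a₂₀≡0 (trans (at 2F column₁≡) (zeroʳ c)) (at 2F AP≡′))) β′≡-c
    a₃₂≡0 : a₃₂ ≡ 0#
    a₃₂≡0 = *-cancelʳ b≢0 (trans (through-P a₃₀ a₃₁ a₃₂ a₃₃ a₃₀≡0 (trans (at 3F column₁≡) (zeroʳ c)) (at 3F AP≡′)) (sym (zeroˡ b)))
    Q-e₃ : a₂₃ * a₂₃ + - (a₀₃ * a₃₃) ≡ 0#
    Q-e₃ = begin
      Q (column A 3F)        ≡⟨ cong Q (·-e A 3F) ⟨
      Q (A · e 3F)           ≡⟨ Q-∘ (e 3F) ⟩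
      k * Q (e 3F)           ≡⟨ solve 1 (λ k → k :* Qᴾ (eᴾ 3F) := 0ᴾ) refl k ⟩
      0#                     ∎
    Q-e₀₃ : (a₂₀ + a₂₃) * (a₂₀ + a₂₃) + - ((a₀₀ + a₀₃) * (a₃₀ + a₃₃)) ≡ - k
    Q-e₀₃ = begin
      _                                      ≡⟨ cong Q (map-cong dot-e₀+e₃ A) ⟨
      Q (A · (1# ∷ 0# ∷ 0# ∷ 1# ∷ []))       ≡⟨ Q-∘ _ ⟩
      k * Q (1# ∷ 0# ∷ 0# ∷ 1# ∷ [])         ≡⟨ solve 1 (λ k → k :* Qᴾ (1ᴾ ∷ 0ᴾ ∷ 0ᴾ ∷ 1ᴾ ∷ []) := :- k) refl k ⟩
      - k                                    ∎
      where
      dot-e₀+e₃ : ∀ (r : V4) → dot r (1# ∷ 0# ∷ 0# ∷ 1# ∷ []) ≡ lookup r 0F + lookup r 3F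
      dot-e₀+e₃ (r₀ ∷ r₁ ∷ r₂ ∷ r₃ ∷ []) =
        solve 4 (λ r₀ r₁ r₂ r₃ → dotᴾ (r₀ ∷ r₁ ∷ r₂ ∷ r₃ ∷ []) (1ᴾ ∷ 0ᴾ ∷ 0ᴾ ∷ 1ᴾ ∷ []) := r₀ :+ r₃) refl r₀ r₁ r₂ r₃

  δ≡-ν : ∀ {s b} → s ≢ 0# → b ≢ 0# → ∀ {A} → Similitude A →
         (∀ x → OnLine (e 0F) (P s b) x → OnLine (e 0F) (P (- s) b) (A · x)) → δ A ≡ - ν A
  δ≡-ν {s} {b} s≢0 b≢0 {A} sim maps = δ≡-ν-of-images s≢0 b≢0 A sim (maps (e 0F) (1# , 0# , O∈ℓ⁺)) (maps (P s b) (0# , 1# , P∈ℓ⁺))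
    where
    O∈ℓ⁺ : e 0F ≡ (1# ⊙ e 0F) ⊕ (0# ⊙ P s b)
    O∈ℓ⁺ = sym (trans (span-O-P 1# 0# s b) (≡-V4 (+-identityʳ 1#) (zeroˡ _) (zeroˡ b) refl))
    P∈ℓ⁺ : P s b ≡ (0# ⊙ e 0F) ⊕ (1# ⊙ P s b)
    P∈ℓ⁺ = sym (trans (span-O-P 0# 1# s b) (≡-V4 (+-identityˡ 1#) (*-identityˡ _) (*-identityˡ b) refl))

  InFq-^q+1 : ∀ {t} → InFq t → t ^ (q ℕ.+ 1) ≡ t * t
  InFq-^q+1 {t} tᵠ≡t = trans (^-distribˡ-+-* t q 1) (cong₂ _*_ tᵠ≡t (*-identityʳ t))

  InFq-neg : ∀ {t} → Odd q → InFq t → InFq (- t)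
  InFq-neg {t} q-odd tᵠ≡t = trans (-‿^-odd t q-odd) (cong -_ tᵠ≡t)

  ℓ⁺≁ℓ⁻ : Odd q → Odd half → 1# + 1# ≢ 0# → ∀ {p s b} → Odd p → s ≢ 0# → b ≢ 0# →
          ¬ SameHOrbit p (e 0F) (P s b) (e 0F) (P (- s) b)
  ℓ⁺≁ℓ⁻ q-odd half-odd 2≢0 p-odd s≢0 b≢0 (A , A∈𝔥 , maps , _) with InH⇒χ≡1 q-odd half-odd p-odd A∈𝔥
  ... | invA , χA = ^-≢0 half (ν≢0 invA) (x≡-x⇒x≡0 2≢0 (begin
    ν A ^ half        ≡⟨ χA ⟨
    δ A ^ half        ≡⟨ cong (_^ half) (δ≡-ν s≢0 b≢0 (InvertibleSimilitude.similitude invA) maps) ⟩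
    (- ν A) ^ half    ≡⟨ -‿^-odd (ν A) half-odd ⟩
    - (ν A ^ half)    ∎))

lemma7p14 : (F : FiniteField) (p k q : ℕ) → Prime p → 1 ≤ k → q ≡ p Data.Nat.^ k →
    card F ≡ q Data.Nat.* q → q % 4 ≡ 1 →
    let open FiniteField F
        open Geometry F q
    in (∃ λ t → InFq t × t * t ≡ 2#) →
       (s : Carrier) → InFq s → s * s ≡ - 2# →
       (b : Carrier) → b ≢ 0# → b ^ q + b ≡ 0# →
       let O  = 1# ∷ 0# ∷ 0# ∷ 0# ∷ []
           P+ = 1# ∷ s * b ∷ b ∷ 0# ∷ []
           P- = 1# ∷ (- s) * b ∷ b ∷ 0# ∷ []
       in IsGenerator O P+ × IsGenerator O P- × ¬ SameHOrbit p O P+ O P-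
lemma7p14 F p k q _ 1≤k q≡pᵏ card≡q² q%4≡1 _ s s∈Fq s²≡-2 b b≢0 _ =
  generator-line q-odd b (trans (InFq-^q+1 s∈Fq) s²≡-2) ,
  generator-line q-odd b (trans (InFq-^q+1 (InFq-neg q-odd s∈Fq)) (trans (-x*-x≡x*x s) s²≡-2)) ,
  ℓ⁺≁ℓ⁻ q-odd half-odd 2≢0 p-odd (x*x≡-2⇒x≢0 2≢0 s²≡-2) b≢0
  where
  open FiniteField F
  open Collineations F q
  open Parity
  q-odd : Odd q
  q-odd = proj₁ (odd-of-%4≡1 q q%4≡1)
  half-odd : Odd (Geometry.half F q)
  half-odd = proj₂ (odd-of-%4≡1 q q%4≡1)
  p-odd : Odd p
  p-odd = odd-base p k 1≤k (subst Odd q≡pᵏ q-odd)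
  2≢0 : 1# + 1# ≢ 0#
  2≢0 = Characteristic.2≢0 F (subst Odd (sym card≡q²) (odd-* q-odd q-odd))
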